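{- For every reflection complex $N$, its frame $\mathcal{F}(N)$ is a coupling frame, i.e. $\mathcal{F}(N)\in\mathfrak{S}$.
   Context: Reflection complexes: a $b$-hypergraph is $M=(V,E,B)$ with $V$ finite, $E\subseteq 2^V$, $B\subseteq2^V\times2^V$ symmetric. For $L\in E$, $X\subseteq L$: $r_{L,X}(M)$ has vertex set $V'$ = disjoint union of $V$ and $L$ with the two copies of each $x\in X$ identified (injections $\tau_1:V\to V'$, $\tau_2:L\to V'$); edges $\tau_1(K)$ ($K\in E$), $\tau_2(K)$ ($K\in E,K\subseteq L$), and $\tau_1(K_1)\cup\tau_2(K_2)$ for all $K_1,K_2\in E$ with $K_2\subseteq L$, $X\subseteq K_1\cap K_2$; relation: $\tau_1$-images of pairs in $B$, $\tau_2$-images of pairs in $B\cap(2^L\times2^L)$, and pairs $(\tau_1(K_1),\tau_2(K_2))$ (and reverses) for such $K_1,K_2$. A reflection complex is obtained from $(\{1,2\},\{\{1,2\}\},\emptyset)$ by finitely many such operations; its frame $\mathcal{F}(N)$ is the graph on its vertex set formed by the $2$-element edges. Coupling frames: a probability scheme with frame $H$ assigns to each finite graph $G$ with nonempty edge set a distribution on the set $\mathrm{Hom}(H,G)$ of homomorphisms. For injective $\beta:S\to V(H)$, $f|_\beta(G)$ is the push-forward under $\varphi\mapsto\varphi\circ\beta$. Given schemes $f_1,f_2$ with frames $H_1,H_2$ and injective $\beta_i:[n]\to V(H_i)$ with $f_1(G)|_{\beta_1}=f_2(G)|_{\beta_2}=:\mu_3(G)$ for all $G$, $C(f_1,f_2,\beta_1,\beta_2)$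 has frame obtained from the disjoint union of $H_1,H_2$ by identifying $\beta_1(j)$ with $\beta_2(j)$ (multiple edges deleted) and gives $\varphi$ (restrictions $\varphi_1,\varphi_2$) probability $f_1(G)(\varphi_1)f_2(G)(\varphi_2)/\mu_3(G)(\varphi_1\circ\beta_1)$ ($0$ if denominator $0$). $\mathfrak{A}$ is the smallest set of schemes containing $G\mapsto\tau(e,G)$ (uniform distribution on homomorphisms of the one-edge graph) and closed under these couplings; $\mathfrak{S}$ is the set of (isomorphism types of) frames of elements of $\mathfrak{A}$. -}

module Defs where

open import Level using (0ℓ)
open import Data.Nat using (ℕ; zero; suc)
open import Data.Fin using (Fin; zero; suc; _≟_)
open import Data.Bool using (Bool; true; false; _∧_; not; if_then_else_)
open import Data.List using (List; []; _∷_; map; concatMap; allFin; foldr)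
open import Data.Bool.ListAction using (all; any)
open import Data.Vec using (tabulate; lookup)
import Data.Vec.Functional as VF
open import Data.Fin.Subset using (Subset; _∈_; _⊆_; _∩_; _∪_; ⁅_⁆) renaming (⊤ to full)
open import Data.Rational using (ℚ; 0ℚ; 1ℚ; _+_; _*_; _/_; 1/_; ≢-nonZero)
open import Data.Integer using (+_)
open import Data.Empty using (⊥)
open import Data.Product using (Σ; ∃; ∃₂; _×_; _,_)
open import Data.Sum using (_⊎_)
open import Relation.Nullary using (¬_; yes; no; does)
open import Relation.Binary.PropositionalEquality using (_≡_; _≢_)
open import Function using (_∘_; _⇔_; _↔_)

record Graph (k : ℕ) : Set where
  field
    adj    : Fin k → Fin k → Bool
    sym    : ∀ i j → adj i j ≡ adj j i
    irrefl : ∀ i → adj i i ≡ false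
open Graph public

HasEdge : ∀ {m} → Graph m → Set
HasEdge G = ∃₂ λ i j → adj G i j ≡ true

edgeAdj : Fin 2 → Fin 2 → Bool
edgeAdj zero (suc zero) = true
edgeAdj (suc zero) zero = true
edgeAdj _ _ = false

edgeGraph : Graph 2
edgeGraph = record { adj = edgeAdj ; sym = s ; irrefl = r }
  where
  s : ∀ i j → edgeAdj i j ≡ edgeAdj j i
  s zero zero = _≡_.refl
  s zero (suc zero) = _≡_.refl
  s (suc zero) zero = _≡_.refl
  s (suc zero) (suc zero) = _≡_.refl
  r : ∀ i → edgeAdj i i ≡ false
  r zero = _≡_.refl
  r (suc zero) = _≡_.refl

isHom : ∀ {k m} → Graph k → Graph m → (Fin k → Fin m) → Bool
isHom H G φ = all (λ i → all (λ j → if adj H i j then adj G (φ i) (φ j) else true) (allFin _)) (allFin _)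

allFuns : (k m : ℕ) → List (Fin k → Fin m)
allFuns zero m = VF.[] ∷ []
allFuns (suc k) m = concatMap (λ a → map (λ f → a VF.∷ f) (allFuns k m)) (allFin m)

count : ∀ {A : Set} → (A → Bool) → List A → ℕ
count p [] = 0
count p (x ∷ xs) = if p x then suc (count p xs) else count p xs

sumℚ : List ℚ → ℚ
sumℚ = foldr _+_ 0ℚ

recipℕ : ℕ → ℚ
recipℕ zero = 0ℚ
recipℕ (suc n) = + 1 / suc n

-- p / q, with value 0 if q = 0
divℚ : ℚ → ℚ → ℚ
divℚ p q with q Data.Rational.≟ 0ℚ
... | yes _ = 0ℚ
... | no q≢0 = p * (1/_ q {{≢-nonZero q≢0}})

eqFun : ∀ {n m} → (Fin n → Fin m) → (Fin n → Fin m) → Bool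
eqFun φ ψ = all (λ j → does (φ j ≟ ψ j)) (allFin _)

-- A scheme assigns to each finite graph G on Fin m a function giving the
-- probability of each map Fin k → Fin m (a distribution on Hom(H,G),
-- i.e. zero off homomorphisms).  Only its values on graphs with an edge
-- matter (see compat in InA).

Scheme : ℕ → Set
Scheme k = (m : ℕ) → Graph m → (Fin k → Fin m) → ℚ

τe : Scheme 2
τe m G φ = if isHom edgeGraph G φ then recipℕ (count (isHom edgeGraph G) (allFuns 2 m)) else 0ℚ

restrict : ∀ {n k} → Scheme k → (Fin n → Fin k) → (m : ℕ) → Graph m → (Fin n → Fin m) → ℚ
restrict {k = k} f β m G ψ = sumℚ (map (λ φ → if eqFun (φ ∘ β) ψ then f m G φ else 0ℚ) (allFuns k m))

Injective : ∀ {a b} → (Fin a → Fin b) → Set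
Injective f = ∀ {x y} → f x ≡ f y → x ≡ y

-- H (on Fin k) together with ι₁, ι₂ is the graph obtained from the disjoint
-- union of H₁, H₂ by identifying β₁ j with β₂ j (multiple edges deleted).
record IsCoupledFrame {k₁ k₂ n k : ℕ} (H₁ : Graph k₁) (H₂ : Graph k₂)
         (β₁ : Fin n → Fin k₁) (β₂ : Fin n → Fin k₂) (H : Graph k)
         (ι₁ : Fin k₁ → Fin k) (ι₂ : Fin k₂ → Fin k) : Set where
  field
    inj₁  : Injective ι₁
    inj₂  : Injective ι₂
    glue  : ∀ x y → (ι₁ x ≡ ι₂ y) ⇔ (∃ λ j → β₁ j ≡ x × β₂ j ≡ y)
    cover : ∀ w → (∃ λ x → ι₁ x ≡ w) ⊎ (∃ λ y → ι₂ y ≡ w)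
    edges : ∀ u w → (adj H u w ≡ true) ⇔
              ((∃₂ λ x y → adj H₁ x y ≡ true × ι₁ x ≡ u × ι₁ y ≡ w)
               ⊎ (∃₂ λ x y → adj H₂ x y ≡ true × ι₂ x ≡ u × ι₂ y ≡ w))

coupled : ∀ {k₁ k₂ n k} → Scheme k₁ → Scheme k₂ → (Fin n → Fin k₁)
          → (Fin k₁ → Fin k) → (Fin k₂ → Fin k) → Scheme k
coupled f₁ f₂ β₁ ι₁ ι₂ m G φ =
  divℚ (f₁ m G (φ ∘ ι₁) * f₂ m G (φ ∘ ι₂)) (restrict f₁ β₁ m G (φ ∘ ι₁ ∘ β₁))

data InA : ∀ {k} → Graph k → Scheme k → Set where
  base   : InA edgeGraph τe
  couple : ∀ {k₁ k₂ n k} {H₁ : Graph k₁} {H₂ : Graph k₂} {f₁ f₂}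
           → InA H₁ f₁ → InA H₂ f₂
           → (β₁ : Fin n → Fin k₁) (β₂ : Fin n → Fin k₂)
           → Injective β₁ → Injective β₂
           → (∀ m (G : Graph m) → HasEdge G → ∀ ψ →
                restrict f₁ β₁ m G ψ ≡ restrict f₂ β₂ m G ψ)
           → (H : Graph k) (ι₁ : Fin k₁ → Fin k) (ι₂ : Fin k₂ → Fin k)
           → IsCoupledFrame H₁ H₂ β₁ β₂ H ι₁ ι₂
           → InA H (coupled f₁ f₂ β₁ ι₁ ι₂)

image : ∀ {v v'} → (Fin v → Fin v') → Subset v → Subset v'
image {v} f K = tabulate λ w → any (λ x → lookup K x ∧ does (f x ≟ w)) (allFin v)

-- V' with injections τ₁ : V → V', τ₂ : L → V' (τ₂ only relevant on L) is the
-- disjoint union of V and L with the two copies of each x ∈ X identified.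
record IsReflectionVertexSet {v v' : ℕ} (L X : Subset v) (τ₁ τ₂ : Fin v → Fin v') : Set where
  field
    inj₁  : Injective τ₁
    inj₂  : ∀ x y → x ∈ L → y ∈ L → τ₂ x ≡ τ₂ y → x ≡ y
    glue  : ∀ x y → y ∈ L → (τ₁ x ≡ τ₂ y) ⇔ (x ≡ y × x ∈ X)
    cover : ∀ w → (∃ λ x → τ₁ x ≡ w) ⊎ (∃ λ y → y ∈ L × τ₂ y ≡ w)

Admissible : ∀ {v} → (Subset v → Set) → Subset v → Subset v → Subset v → Subset v → Set
Admissible E L X K₁ K₂ = E K₁ × E K₂ × K₂ ⊆ L × X ⊆ (K₁ ∩ K₂)

reflE : ∀ {v v'} → (Subset v → Set) → Subset v → Subset v → (Fin v → Fin v') → (Fin v → Fin v')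
        → Subset v' → Set
reflE E L X τ₁ τ₂ K' =
  (∃ λ K → E K × K' ≡ image τ₁ K)
  ⊎ (∃ λ K → E K × K ⊆ L × K' ≡ image τ₂ K)
  ⊎ (∃₂ λ K₁ K₂ → Admissible E L X K₁ K₂ × K' ≡ (image τ₁ K₁ ∪ image τ₂ K₂))

reflB : ∀ {v v'} → (Subset v → Set) → (Subset v → Subset v → Set) → Subset v → Subset v
        → (Fin v → Fin v') → (Fin v → Fin v') → Subset v' → Subset v' → Set
reflB E B L X τ₁ τ₂ P' Q' =
  (∃₂ λ P Q → B P Q × P' ≡ image τ₁ P × Q' ≡ image τ₁ Q)
  ⊎ (∃₂ λ P Q → B P Q × P ⊆ L × Q ⊆ L × P' ≡ image τ₂ P × Q' ≡ image τ₂ Q)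
  ⊎ (∃₂ λ K₁ K₂ → Admissible E L X K₁ K₂ × P' ≡ image τ₁ K₁ × Q' ≡ image τ₂ K₂)
  ⊎ (∃₂ λ K₁ K₂ → Admissible E L X K₁ K₂ × P' ≡ image τ₂ K₂ × Q' ≡ image τ₁ K₁)

data ReflectionComplex : (v : ℕ) → (Subset v → Set) → (Subset v → Subset v → Set) → Set₁ where
  start   : ReflectionComplex 2 (λ K → K ≡ full) (λ _ _ → ⊥)
  reflect : ∀ {v v' E B} → ReflectionComplex v E B
            → (L X : Subset v) → E L → X ⊆ L
            → (τ₁ τ₂ : Fin v → Fin v') → IsReflectionVertexSet L X τ₁ τ₂
            → ReflectionComplex v' (reflE E L X τ₁ τ₂) (reflB E B L X τ₁ τ₂)

FrameAdj : ∀ {v} → (Subset v → Set) → Fin v → Fin v → Set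
FrameAdj E u w = u ≢ w × E (⁅ u ⁆ ∪ ⁅ w ⁆)

-- a graph on Fin v given by an adjacency predicate is (isomorphic to) a
-- frame in 𝔖
InS : ∀ {v} → (Fin v → Fin v → Set) → Set
InS {v} A = ∃ λ k → Σ (Graph k) λ H → ∃ λ f → InA H f ×
              Σ (Fin v ↔ Fin k) λ σ → ∀ u w →
                (adj H (Function.Inverse.to σ u) (Function.Inverse.to σ w) ≡ true) ⇔ A u w

module Submission where

-- The proof is an induction over the construction of N carrying a stronger
-- invariant (FrameInvariant below): besides a scheme f ∈ 𝔄 whose frame is
-- F(N), we keep for every edge K of N a scheme g_K ∈ 𝔄 whose frame is the
-- induced frame on K and which equals the marginal f|_K.  A reflection
-- r_{L,X} glues a second copy of L onto V along X; correspondingly we couple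
-- f with g_L along X.  The marginal calculus of couplings then supplies the
-- new edge schemes: the marginal of C(f₁,f₂) on a part of one side is the
-- marginal of that side, and on a union of parts of both sides it is the
-- coupling of the two marginals.

open import Defs hiding (sym)
open import Data.Nat using (ℕ; zero; suc)
open import Data.Fin using (Fin; zero; suc; _≟_)
open import Data.Fin.Properties using (suc-injective)
open import Data.Fin.Subset using (Subset; _∈_; _⊆_; _∩_; _∪_; ⁅_⁆) renaming (⊤ to full)
open import Data.Fin.Subset.Properties using (⊆-antisym; x∈⁅x⁆; x∈⁅y⁆⇒x≡y; x∈p∪q⁻; x∈p∪q⁺; x∈p∩q⁻; _∈?_; ∈⊤)
open import Data.Bool using (Bool; true; false; _∧_; _∨_; if_then_else_)
open import Data.Bool.Properties using (T-≡)
open import Data.Bool.ListAction using (all; any; and)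
open import Data.List using (List; []; _∷_; map; concatMap; allFin; _++_)
open import Data.List.Properties using (map-tabulate; map-∘)
import Data.List.Relation.Unary.Any as Any
open import Data.List.Relation.Unary.Any using (satisfied)
open import Data.List.Relation.Unary.Any.Properties using (any⁺; any⁻)
open import Data.List.Membership.Propositional.Properties using (∈-allFin)
open import Data.Vec using (lookup)
open import Data.Vec.Properties using ([]=⇒lookup; lookup⇒[]=; lookup∘tabulate)
import Data.Vec.Functional as VF
open import Data.Rational using (ℚ; 0ℚ; 1ℚ; _+_; _*_; _≤_; 1/_; ≢-nonZero)
import Data.Rational as ℚ
open import Data.Rational.Properties
  using (+-identityˡ; +-identityʳ; +-assoc; *-zeroʳ; *-zeroˡ; *-identityˡ; *-identityʳ; *-comm;
         *-distribˡ-+; *-assoc; *-inverseˡ; ≤-refl; ≤-trans; ≤-antisym; ≤-reflexive; +-mono-≤;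
         nonNegative⁻¹; nonNeg*nonNeg⇒nonNeg; pos⇒nonNeg; 1/pos⇒pos; nonNeg∧nonZero⇒pos;
         normalize-nonNeg; +-*-commutativeRing; +-0-commutativeMonoid)
open import Data.Rational.Base using (nonNegative)
open import Data.Product using (∃; ∃₂; _×_; _,_; proj₁; proj₂)
open import Data.Sum using (_⊎_; inj₁; inj₂)
open import Data.Empty using (⊥; ⊥-elim)
open import Data.Maybe using (nothing)
open import Relation.Nullary using (¬_; Dec; yes; no; does)
open import Relation.Nullary.Decidable using (dec-true)
open import Relation.Binary.PropositionalEquality
open import Function using (_∘_; id)
open import Function.Bundles using (Equivalence; mk⇔; _⇔_)
open import Function.Construct.Identity using (↔-id)
open import Function.Construct.Composition using (_⇔-∘_)
open import Function.Construct.Symmetry using (⇔-sym)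
open import Tactic.RingSolver using (solve-∀)
open import Tactic.RingSolver.Core.AlmostCommutativeRing using (AlmostCommutativeRing; fromCommutativeRing)
open import Level using (0ℓ)
open import Algebra.Bundles using (CommutativeMonoid)
import Algebra.Properties.CommutativeSemigroup as CommSemigroupProperties
open ≡-Reasoning

open CommSemigroupProperties (CommutativeMonoid.commutativeSemigroup +-0-commutativeMonoid)
  using () renaming (interchange to +-interchange)

-- Finite sums over lists

∑ : {A : Set} → List A → (A → ℚ) → ℚ
∑ l F = sumℚ (map F l)

∑-cong : {A : Set} (l : List A) {F G : A → ℚ} → (∀ x → F x ≡ G x) → ∑ l F ≡ ∑ l G
∑-cong []      e = refl
∑-cong (x ∷ l) e = cong₂ _+_ (e x) (∑-cong l e)

∑-zero : {A : Set} (l : List A) → ∑ l (λ _ → 0ℚ) ≡ 0ℚ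
∑-zero []      = refl
∑-zero (x ∷ l) = trans (+-identityˡ _) (∑-zero l)

∑-+ : {A : Set} (l : List A) (F G : A → ℚ) → ∑ l (λ x → F x + G x) ≡ ∑ l F + ∑ l G
∑-+ []      F G = refl
∑-+ (x ∷ l) F G = trans (cong ((F x + G x) +_) (∑-+ l F G)) (+-interchange (F x) (G x) (∑ l F) (∑ l G))

∑-*ˡ : {A : Set} (l : List A) (c : ℚ) (F : A → ℚ) → ∑ l (λ x → c * F x) ≡ c * ∑ l F
∑-*ˡ []      c F = sym (*-zeroʳ c)
∑-*ˡ (x ∷ l) c F = trans (cong (c * F x +_) (∑-*ˡ l c F)) (sym (*-distribˡ-+ c (F x) _))

∑-*ʳ : {A : Set} (l : List A) (c : ℚ) (F : A → ℚ) → ∑ l (λ x → F x * c) ≡ ∑ l F * c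
∑-*ʳ l c F = trans (∑-cong l (λ x → *-comm (F x) c)) (trans (∑-*ˡ l c F) (*-comm c _))

∑-swap : {A B : Set} (l : List A) (l' : List B) (F : A → B → ℚ) →
         ∑ l (λ x → ∑ l' (F x)) ≡ ∑ l' (λ y → ∑ l (λ x → F x y))
∑-swap []      l' F = sym (∑-zero l')
∑-swap (x ∷ l) l' F = trans (cong (∑ l' (F x) +_) (∑-swap l l' F)) (sym (∑-+ l' (F x) _))

∑-++ : {A : Set} (l l' : List A) (F : A → ℚ) → ∑ (l ++ l') F ≡ ∑ l F + ∑ l' F
∑-++ []      l' F = sym (+-identityˡ _)
∑-++ (x ∷ l) l' F = trans (cong (F x +_) (∑-++ l l' F)) (sym (+-assoc (F x) _ _))

∑-concatMap : {A B : Set} (g : A → List B) (l : List A) (F : B → ℚ) →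
              ∑ (concatMap g l) F ≡ ∑ l (λ a → ∑ (g a) F)
∑-concatMap g []      F = refl
∑-concatMap g (x ∷ l) F = trans (∑-++ (g x) (concatMap g l) F) (cong (∑ (g x) F +_) (∑-concatMap g l F))

∑-map : {A B : Set} (h : A → B) (l : List A) (F : B → ℚ) → ∑ (map h l) F ≡ ∑ l (F ∘ h)
∑-map h l F = cong sumℚ (sym (map-∘ l))

∑-allFin-suc : ∀ n (F : Fin (suc n) → ℚ) → ∑ (allFin (suc n)) F ≡ F zero + ∑ (allFin n) (F ∘ suc)
∑-allFin-suc n F =
  cong (F zero +_) (trans (cong sumℚ (map-tabulate suc F)) (sym (cong sumℚ (map-tabulate id (F ∘ suc)))))

𝟙 : Bool → ℚ
𝟙 true  = 1ℚ
𝟙 false = 0ℚ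

if-as-𝟙 : ∀ b x → (if b then x else 0ℚ) ≡ 𝟙 b * x
if-as-𝟙 true  x = sym (*-identityˡ x)
if-as-𝟙 false x = sym (*-zeroˡ x)

𝟙-∧ : ∀ a b → 𝟙 (a ∧ b) ≡ 𝟙 a * 𝟙 b
𝟙-∧ true  b = sym (*-identityˡ _)
𝟙-∧ false b = sym (*-zeroˡ (𝟙 b))

∑-if : ∀ {A : Set} (l : List A) b (F : A → ℚ) → ∑ l (λ x → if b then F x else 0ℚ) ≡ (if b then ∑ l F else 0ℚ)
∑-if l true  F = refl
∑-if l false F = ∑-zero l

∑-delta-Fin : ∀ m (b : Fin m) (G : Fin m → ℚ) → ∑ (allFin m) (λ a → if does (a ≟ b) then G a else 0ℚ) ≡ G b
∑-delta-Fin (suc m) zero G = begin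
  ∑ (allFin (suc m)) (λ a → if does (a ≟ zero) then G a else 0ℚ)
    ≡⟨ ∑-allFin-suc m (λ a → if does (a ≟ zero) then G a else 0ℚ) ⟩
  G zero + ∑ (allFin m) (λ _ → 0ℚ)
    ≡⟨ cong (G zero +_) (∑-zero (allFin m)) ⟩
  G zero + 0ℚ
    ≡⟨ +-identityʳ (G zero) ⟩
  G zero ∎
∑-delta-Fin (suc m) (suc b) G = begin
  ∑ (allFin (suc m)) (λ a → if does (a ≟ suc b) then G a else 0ℚ)
    ≡⟨ trans (∑-allFin-suc m (λ a → if does (a ≟ suc b) then G a else 0ℚ)) (+-identityˡ _) ⟩
  ∑ (allFin m) (λ a → if does (suc a ≟ suc b) then G (suc a) else 0ℚ)
    ≡⟨ ∑-cong (allFin m) suc-test ⟩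
  ∑ (allFin m) (λ a → if does (a ≟ b) then G (suc a) else 0ℚ)
    ≡⟨ ∑-delta-Fin m b (G ∘ suc) ⟩
  G (suc b) ∎
  where
  suc-test : ∀ a → (if does (suc a ≟ suc b) then G (suc a) else 0ℚ) ≡ (if does (a ≟ b) then G (suc a) else 0ℚ)
  suc-test a with a ≟ b
  ... | yes refl = refl
  ... | no _     = refl

∧-split : ∀ {a b} → a ∧ b ≡ true → a ≡ true × b ≡ true
∧-split {true} {true} _ = refl , refl

∧-intro : ∀ {a b} → a ≡ true → b ≡ true → a ∧ b ≡ true
∧-intro refl refl = refl

bool-ext : ∀ {b b'} → (b ≡ true → b' ≡ true) → (b' ≡ true → b ≡ true) → b ≡ b'
bool-ext {true}  {true}  f g = refl
bool-ext {true}  {false} f g = sym (f refl)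
bool-ext {false} {true}  f g = g refl
bool-ext {false} {false} f g = refl

≢true⇒≡false : ∀ {b} → ¬ (b ≡ true) → b ≡ false
≢true⇒≡false {true}  n = ⊥-elim (n refl)
≢true⇒≡false {false} n = refl

does-true : ∀ {n} {a b : Fin n} → does (a ≟ b) ≡ true → a ≡ b
does-true {a = a} {b} e with a ≟ b
... | yes p = p
does-true {a = a} {b} () | no _

any-allFin⁻ : ∀ n (p : Fin n → Bool) → any p (allFin n) ≡ true → ∃ λ i → p i ≡ true
any-allFin⁻ n p e with satisfied (any⁻ p (allFin n) (Equivalence.from T-≡ e))
... | i , pi = i , Equivalence.to T-≡ pi

any-allFin⁺ : ∀ n (p : Fin n → Bool) i → p i ≡ true → any p (allFin n) ≡ true
any-allFin⁺ n p i e = Equivalence.to T-≡ (any⁺ p (Any.map (λ { refl → Equivalence.from T-≡ e }) (∈-allFin i)))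

eqFun-suc : ∀ {k m} (ψ φ : Fin (suc k) → Fin m) →
            eqFun ψ φ ≡ does (ψ zero ≟ φ zero) ∧ eqFun (ψ ∘ suc) (φ ∘ suc)
eqFun-suc {k} ψ φ = cong (does (ψ zero ≟ φ zero) ∧_)
  (trans (cong and (map-tabulate suc test)) (sym (cong and (map-tabulate id (test ∘ suc)))))
  where
  test : Fin (suc k) → Bool
  test j = does (ψ j ≟ φ j)

eqFun-sound : ∀ {k m} (ψ φ : Fin k → Fin m) → eqFun ψ φ ≡ true → ∀ i → ψ i ≡ φ i
eqFun-sound {suc k} ψ φ e zero    = does-true (proj₁ (∧-split (trans (sym (eqFun-suc ψ φ)) e)))
eqFun-sound {suc k} ψ φ e (suc i) =
  eqFun-sound (ψ ∘ suc) (φ ∘ suc) (proj₂ (∧-split (trans (sym (eqFun-suc ψ φ)) e))) i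

eqFun-complete : ∀ {k m} (ψ φ : Fin k → Fin m) → (∀ i → ψ i ≡ φ i) → eqFun ψ φ ≡ true
eqFun-complete {zero}  ψ φ e = refl
eqFun-complete {suc k} ψ φ e = trans (eqFun-suc ψ φ)
  (∧-intro (dec-true (ψ zero ≟ φ zero) (e zero)) (eqFun-complete (ψ ∘ suc) (φ ∘ suc) (e ∘ suc)))

eqFun-resp : ∀ {k m} {ψ ψ' φ φ' : Fin k → Fin m} → ψ ≗ ψ' → φ ≗ φ' → eqFun ψ φ ≡ eqFun ψ' φ'
eqFun-resp {ψ = ψ} {ψ'} {φ} {φ'} p q = bool-ext
  (λ e → eqFun-complete ψ' φ' (λ i → trans (sym (p i)) (trans (eqFun-sound ψ φ e i) (q i))))
  (λ e → eqFun-complete ψ φ (λ i → trans (p i) (trans (eqFun-sound ψ' φ' e i) (sym (q i)))))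

eqFun-sym : ∀ {k m} (ψ φ : Fin k → Fin m) → eqFun ψ φ ≡ eqFun φ ψ
eqFun-sym ψ φ = bool-ext (λ e → eqFun-complete φ ψ (λ i → sym (eqFun-sound ψ φ e i)))
                         (λ e → eqFun-complete ψ φ (λ i → sym (eqFun-sound φ ψ e i)))

∑Maps : (k m : ℕ) → ((Fin k → Fin m) → ℚ) → ℚ
∑Maps k m = ∑ (allFuns k m)

∑Maps-suc : ∀ k m (F : (Fin (suc k) → Fin m) → ℚ) →
            ∑Maps (suc k) m F ≡ ∑ (allFin m) (λ a → ∑Maps k m (λ f → F (a VF.∷ f)))
∑Maps-suc k m F =
  trans (∑-concatMap _ (allFin m) F) (∑-cong (allFin m) (λ a → ∑-map (a VF.∷_) (allFuns k m) F))

-- Without function extensionality, summands must respect pointwise equality.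
Extensional : ∀ {k m} → ((Fin k → Fin m) → ℚ) → Set
Extensional F = ∀ ψ ψ' → ψ ≗ ψ' → F ψ ≡ F ψ'

∷-≗ : ∀ {k m} (a : Fin m) {f f' : Fin k → Fin m} → f ≗ f' → (a VF.∷ f) ≗ (a VF.∷ f')
∷-≗ a e zero    = refl
∷-≗ a e (suc i) = e i

∑Maps-delta : ∀ k m (φ : Fin k → Fin m) (F : (Fin k → Fin m) → ℚ) → Extensional F →
              ∑Maps k m (λ ψ → if eqFun ψ φ then F ψ else 0ℚ) ≡ F φ
∑Maps-delta zero    m φ F ext = trans (+-identityʳ _) (ext VF.[] φ (λ ()))
∑Maps-delta (suc k) m φ F ext = begin
  ∑Maps (suc k) m (λ ψ → if eqFun ψ φ then F ψ else 0ℚ)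
    ≡⟨ ∑Maps-suc k m _ ⟩
  ∑ (allFin m) (λ a → ∑Maps k m (λ f → if eqFun (a VF.∷ f) φ then F (a VF.∷ f) else 0ℚ))
    ≡⟨ ∑-cong (allFin m) (λ a → trans (∑-cong (allFuns k m) (split a)) (∑-if (allFuns k m) (does (a ≟ φ zero)) _)) ⟩
  ∑ (allFin m) (λ a → if does (a ≟ φ zero) then ∑Maps k m (λ f → if eqFun f (φ ∘ suc) then F (a VF.∷ f) else 0ℚ) else 0ℚ)
    ≡⟨ ∑-delta-Fin m (φ zero) _ ⟩
  ∑Maps k m (λ f → if eqFun f (φ ∘ suc) then F (φ zero VF.∷ f) else 0ℚ)
    ≡⟨ ∑Maps-delta k m (φ ∘ suc) (λ f → F (φ zero VF.∷ f)) (λ ψ ψ' e → ext _ _ (∷-≗ (φ zero) e)) ⟩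
  F (φ zero VF.∷ (φ ∘ suc))
    ≡⟨ ext _ _ (λ { zero → refl ; (suc i) → refl }) ⟩
  F φ ∎
  where
  split : ∀ a f → (if eqFun (a VF.∷ f) φ then F (a VF.∷ f) else 0ℚ) ≡
                  (if does (a ≟ φ zero) then (if eqFun f (φ ∘ suc) then F (a VF.∷ f) else 0ℚ) else 0ℚ)
  split a f rewrite eqFun-suc (a VF.∷ f) φ with does (a ≟ φ zero)
  ... | true  = refl
  ... | false = refl

∑Maps-delta-count : ∀ k m (φ : Fin k → Fin m) → ∑Maps k m (λ ψ → 𝟙 (eqFun ψ φ)) ≡ 1ℚ
∑Maps-delta-count k m φ =
  trans (∑-cong (allFuns k m) (λ ψ → 𝟙-as-if (eqFun ψ φ))) (∑Maps-delta k m φ (λ _ → 1ℚ) (λ _ _ _ → refl))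
  where
  𝟙-as-if : ∀ b → 𝟙 b ≡ (if b then 1ℚ else 0ℚ)
  𝟙-as-if true  = refl
  𝟙-as-if false = refl

Extensional₂ : ∀ {k₁ k₂ m} → ((Fin k₁ → Fin m) → (Fin k₂ → Fin m) → ℚ) → Set
Extensional₂ F = ∀ φ₁ φ₁' φ₂ φ₂' → φ₁ ≗ φ₁' → φ₂ ≗ φ₂' → F φ₁ φ₂ ≡ F φ₁' φ₂'

-- For a coupled frame H (H₁ and H₂ glued along β₁, β₂), a map φ on V(H) is
-- the same as a pair of maps on V(H₁), V(H₂) that agree on the interface.
module GluedMaps {k₁ k₂ n k} {H₁ : Graph k₁} {H₂ : Graph k₂} {β₁ : Fin n → Fin k₁} {β₂ : Fin n → Fin k₂}
                 {H : Graph k} {ι₁ : Fin k₁ → Fin k} {ι₂ : Fin k₂ → Fin k}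
                 (CF : IsCoupledFrame H₁ H₂ β₁ β₂ H ι₁ ι₂) where
  open IsCoupledFrame CF using (glue; cover)

  glued-interface : ∀ j → ι₁ (β₁ j) ≡ ι₂ (β₂ j)
  glued-interface j = Equivalence.from (glue (β₁ j) (β₂ j)) (j , refl , refl)

  compatible : ∀ {m} → (Fin k₁ → Fin m) → (Fin k₂ → Fin m) → Bool
  compatible φ₁ φ₂ = eqFun (φ₁ ∘ β₁) (φ₂ ∘ β₂)

  restricts : ∀ {m} → (Fin k → Fin m) → (Fin k₁ → Fin m) → (Fin k₂ → Fin m) → Bool
  restricts φ φ₁ φ₂ = eqFun φ₁ (φ ∘ ι₁) ∧ eqFun φ₂ (φ ∘ ι₂)

  module _ {m : ℕ} (φ₁ : Fin k₁ → Fin m) (φ₂ : Fin k₂ → Fin m) where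

    amalgam : Fin k → Fin m
    amalgam w = pick (cover w)
      where
      pick : (∃ λ x → ι₁ x ≡ w) ⊎ (∃ λ y → ι₂ y ≡ w) → Fin m
      pick (inj₁ (x , _)) = φ₁ x
      pick (inj₂ (y , _)) = φ₂ y

    amalgam-ι₁ : (∀ j → φ₁ (β₁ j) ≡ φ₂ (β₂ j)) → ∀ x → amalgam (ι₁ x) ≡ φ₁ x
    amalgam-ι₁ c x with cover (ι₁ x)
    ... | inj₁ (x' , e) = cong φ₁ (IsCoupledFrame.inj₁ CF e)
    ... | inj₂ (y , e) with Equivalence.to (glue x y) (sym e)
    ... | j , refl , refl = sym (c j)

    amalgam-ι₂ : (∀ j → φ₁ (β₁ j) ≡ φ₂ (β₂ j)) → ∀ y → amalgam (ι₂ y) ≡ φ₂ y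
    amalgam-ι₂ c y with cover (ι₂ y)
    ... | inj₂ (y' , e) = cong φ₂ (IsCoupledFrame.inj₂ CF e)
    ... | inj₁ (x , e) with Equivalence.to (glue x y) e
    ... | j , refl , refl = c j

    amalgam-unique : ∀ (φ : Fin k → Fin m) → (∀ x → φ (ι₁ x) ≡ φ₁ x) → (∀ y → φ (ι₂ y) ≡ φ₂ y) → φ ≗ amalgam
    amalgam-unique φ e₁ e₂ w with cover w
    ... | inj₁ (x , refl) = e₁ x
    ... | inj₂ (y , refl) = e₂ y

    restricts⇔amalgam : compatible φ₁ φ₂ ≡ true → ∀ φ → restricts φ φ₁ φ₂ ≡ eqFun φ amalgam
    restricts⇔amalgam eq φ = bool-ext
      (λ e → let (a , b) = ∧-split {eqFun φ₁ (φ ∘ ι₁)} e in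
             eqFun-complete φ amalgam (amalgam-unique φ (λ x → sym (eqFun-sound φ₁ (φ ∘ ι₁) a x))
                                                        (λ y → sym (eqFun-sound φ₂ (φ ∘ ι₂) b y))))
      (λ e → let u = eqFun-sound φ amalgam e in ∧-intro
             (eqFun-complete φ₁ (φ ∘ ι₁) (λ x → trans (sym (amalgam-ι₁ c x)) (sym (u (ι₁ x)))))
             (eqFun-complete φ₂ (φ ∘ ι₂) (λ y → trans (sym (amalgam-ι₂ c y)) (sym (u (ι₂ y))))))
      where
      c = eqFun-sound (φ₁ ∘ β₁) (φ₂ ∘ β₂) eq

    restricts-incompatible : compatible φ₁ φ₂ ≡ false → ∀ φ → restricts φ φ₁ φ₂ ≡ false
    restricts-incompatible eq φ = ≢true⇒≡false λ e →
      let (a , b) = ∧-split {eqFun φ₁ (φ ∘ ι₁)} e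
          u = eqFun-sound φ₁ (φ ∘ ι₁) a
          v = eqFun-sound φ₂ (φ ∘ ι₂) b
          agree = eqFun-complete (φ₁ ∘ β₁) (φ₂ ∘ β₂)
                    (λ j → trans (u (β₁ j)) (trans (cong φ (glued-interface j)) (sym (v (β₂ j)))))
      in true≢false (trans (sym agree) eq)
      where
      true≢false : true ≡ false → ⊥
      true≢false ()

    𝟙-restricts : ∀ φ → 𝟙 (eqFun φ₁ (φ ∘ ι₁)) * 𝟙 (eqFun φ₂ (φ ∘ ι₂)) ≡ 𝟙 (restricts φ φ₁ φ₂)
    𝟙-restricts φ = sym (𝟙-∧ (eqFun φ₁ (φ ∘ ι₁)) (eqFun φ₂ (φ ∘ ι₂)))

    amalgam-count : ∑Maps k m (λ φ → 𝟙 (eqFun φ₁ (φ ∘ ι₁)) * 𝟙 (eqFun φ₂ (φ ∘ ι₂))) ≡ 𝟙 (compatible φ₁ φ₂)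
    amalgam-count with compatible φ₁ φ₂ in eq
    ... | true  = trans (∑-cong (allFuns k m) (λ φ → trans (𝟙-restricts φ) (cong 𝟙 (restricts⇔amalgam eq φ))))
                        (∑Maps-delta-count k m amalgam)
    ... | false = trans (∑-cong (allFuns k m) (λ φ → trans (𝟙-restricts φ) (cong 𝟙 (restricts-incompatible eq φ))))
                        (∑-zero (allFuns k m))

  ∑-glued : ∀ {m} (F : (Fin k₁ → Fin m) → (Fin k₂ → Fin m) → ℚ) → Extensional₂ F →
            ∑Maps k m (λ φ → F (φ ∘ ι₁) (φ ∘ ι₂)) ≡
            ∑Maps k₁ m (λ φ₁ → ∑Maps k₂ m (λ φ₂ → 𝟙 (compatible φ₁ φ₂) * F φ₁ φ₂))
  ∑-glued {m} F ext = begin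
    ∑Maps k m (λ φ → F (φ ∘ ι₁) (φ ∘ ι₂))
      ≡⟨ ∑-cong (allFuns k m) expand ⟩
    ∑Maps k m (λ φ → ∑Maps k₁ m (λ φ₁ → ∑Maps k₂ m (λ φ₂ → T φ φ₁ φ₂)))
      ≡⟨ ∑-swap (allFuns k m) (allFuns k₁ m) _ ⟩
    ∑Maps k₁ m (λ φ₁ → ∑Maps k m (λ φ → ∑Maps k₂ m (λ φ₂ → T φ φ₁ φ₂)))
      ≡⟨ ∑-cong (allFuns k₁ m) (λ φ₁ → ∑-swap (allFuns k m) (allFuns k₂ m) _) ⟩
    ∑Maps k₁ m (λ φ₁ → ∑Maps k₂ m (λ φ₂ → ∑Maps k m (λ φ → T φ φ₁ φ₂)))
      ≡⟨ ∑-cong (allFuns k₁ m) (λ φ₁ → ∑-cong (allFuns k₂ m) (λ φ₂ → collapse φ₁ φ₂)) ⟩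
    ∑Maps k₁ m (λ φ₁ → ∑Maps k₂ m (λ φ₂ → 𝟙 (compatible φ₁ φ₂) * F φ₁ φ₂)) ∎
    where
    T : (Fin k → Fin m) → (Fin k₁ → Fin m) → (Fin k₂ → Fin m) → ℚ
    T φ φ₁ φ₂ = (𝟙 (eqFun φ₁ (φ ∘ ι₁)) * 𝟙 (eqFun φ₂ (φ ∘ ι₂))) * F φ₁ φ₂

    collapse : ∀ φ₁ φ₂ → ∑Maps k m (λ φ → T φ φ₁ φ₂) ≡ 𝟙 (compatible φ₁ φ₂) * F φ₁ φ₂
    collapse φ₁ φ₂ = trans (∑-*ʳ (allFuns k m) (F φ₁ φ₂) _) (cong (_* F φ₁ φ₂) (amalgam-count φ₁ φ₂))

    expand : ∀ φ → F (φ ∘ ι₁) (φ ∘ ι₂) ≡ ∑Maps k₁ m (λ φ₁ → ∑Maps k₂ m (λ φ₂ → T φ φ₁ φ₂))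
    expand φ = begin
      F (φ ∘ ι₁) (φ ∘ ι₂)
        ≡⟨ sym (∑Maps-delta k₁ m (φ ∘ ι₁) (λ φ₁ → F φ₁ (φ ∘ ι₂)) (λ a b e → ext a b _ _ e (λ _ → refl))) ⟩
      ∑Maps k₁ m (λ φ₁ → if eqFun φ₁ (φ ∘ ι₁) then F φ₁ (φ ∘ ι₂) else 0ℚ)
        ≡⟨ ∑-cong (allFuns k₁ m) (λ φ₁ → trans (if-as-𝟙 (eqFun φ₁ (φ ∘ ι₁)) _) (cong (𝟙 (eqFun φ₁ (φ ∘ ι₁)) *_)
             (sym (∑Maps-delta k₂ m (φ ∘ ι₂) (F φ₁) (λ a b e → ext _ _ a b (λ _ → refl) e))))) ⟩
      ∑Maps k₁ m (λ φ₁ → 𝟙 (eqFun φ₁ (φ ∘ ι₁)) * ∑Maps k₂ m (λ φ₂ → if eqFun φ₂ (φ ∘ ι₂) then F φ₁ φ₂ else 0ℚ))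
        ≡⟨ ∑-cong (allFuns k₁ m) (λ φ₁ → trans (sym (∑-*ˡ (allFuns k₂ m) (𝟙 (eqFun φ₁ (φ ∘ ι₁)))
                                                    (λ φ₂ → if eqFun φ₂ (φ ∘ ι₂) then F φ₁ φ₂ else 0ℚ)))
             (∑-cong (allFuns k₂ m) (λ φ₂ → 𝟙-product (eqFun φ₁ (φ ∘ ι₁)) (eqFun φ₂ (φ ∘ ι₂)) (F φ₁ φ₂)))) ⟩
      ∑Maps k₁ m (λ φ₁ → ∑Maps k₂ m (λ φ₂ → T φ φ₁ φ₂)) ∎
      where
      𝟙-product : ∀ a b x → 𝟙 a * (if b then x else 0ℚ) ≡ (𝟙 a * 𝟙 b) * x
      𝟙-product a b x = trans (cong (𝟙 a *_) (if-as-𝟙 b x)) (sym (*-assoc (𝟙 a) (𝟙 b) x))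

-- Schemes and their marginals

ExtensionalScheme : ∀ {k} → Scheme k → Set
ExtensionalScheme f = ∀ m (G : Graph m) → Extensional (f m G)

NonNegativeScheme : ∀ {k} → Scheme k → Set
NonNegativeScheme f = ∀ m (G : Graph m) φ → 0ℚ ≤ f m G φ

_≈S_ : ∀ {k} → Scheme k → Scheme k → Set
f ≈S g = ∀ m (G : Graph m) → HasEdge G → ∀ φ → f m G φ ≡ g m G φ

restrict-resp : ∀ {n k} (f : Scheme k) (β : Fin n → Fin k) → ExtensionalScheme (restrict f β)
restrict-resp {k = k} f β m G ψ ψ' e = ∑-cong (allFuns k m)
  (λ φ → cong (λ b → if b then f m G φ else 0ℚ) (eqFun-resp {ψ = φ ∘ β} (λ _ → refl) e))

restrict-cong-β : ∀ {n k} (f : Scheme k) {β β' : Fin n → Fin k} → β ≗ β' → ∀ m G ψ →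
                  restrict f β m G ψ ≡ restrict f β' m G ψ
restrict-cong-β {k = k} f {β} {β'} e m G ψ = ∑-cong (allFuns k m)
  (λ φ → cong (λ b → if b then f m G φ else 0ℚ) (eqFun-resp {ψ = φ ∘ β} {φ ∘ β'} (λ i → cong φ (e i)) (λ _ → refl)))

restrict-≈ : ∀ {n k} {f f' : Scheme k} (β : Fin n → Fin k) → f ≈S f' → restrict f β ≈S restrict f' β
restrict-≈ {k = k} β e m G he ψ =
  ∑-cong (allFuns k m) (λ φ → cong (λ x → if eqFun (φ ∘ β) ψ then x else 0ℚ) (e m G he φ))

restrict-id : ∀ {k} (f : Scheme k) → ExtensionalScheme f → ∀ m G ψ → restrict f id m G ψ ≡ f m G ψ
restrict-id {k} f ext m G ψ = ∑Maps-delta k m ψ (f m G) (ext m G)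

restrict-restrict : ∀ {n p k} (f : Scheme k) (γ : Fin p → Fin k) (δ : Fin n → Fin p) → ∀ m G c →
                    restrict (restrict f γ) δ m G c ≡ restrict f (γ ∘ δ) m G c
restrict-restrict {n} {p} {k} f γ δ m G c = begin
  ∑Maps p m (λ α → if eqFun (α ∘ δ) c then ∑Maps k m (λ φ → if eqFun (φ ∘ γ) α then f m G φ else 0ℚ) else 0ℚ)
    ≡⟨ ∑-cong (allFuns p m) (λ α → trans (if-as-𝟙 (eqFun (α ∘ δ) c) _)
         (sym (∑-*ˡ (allFuns k m) (𝟙 (eqFun (α ∘ δ) c)) (λ φ → if eqFun (φ ∘ γ) α then f m G φ else 0ℚ)))) ⟩
  ∑Maps p m (λ α → ∑Maps k m (λ φ → 𝟙 (eqFun (α ∘ δ) c) * (if eqFun (φ ∘ γ) α then f m G φ else 0ℚ)))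
    ≡⟨ ∑-swap (allFuns p m) (allFuns k m) _ ⟩
  ∑Maps k m (λ φ → ∑Maps p m (λ α → 𝟙 (eqFun (α ∘ δ) c) * (if eqFun (φ ∘ γ) α then f m G φ else 0ℚ)))
    ≡⟨ ∑-cong (allFuns k m) collapse ⟩
  ∑Maps k m (λ φ → if eqFun (φ ∘ (γ ∘ δ)) c then f m G φ else 0ℚ) ∎
  where
  -- only α = φ ∘ γ contributes
  collapse : ∀ φ → ∑Maps p m (λ α → 𝟙 (eqFun (α ∘ δ) c) * (if eqFun (φ ∘ γ) α then f m G φ else 0ℚ)) ≡
                   (if eqFun (φ ∘ (γ ∘ δ)) c then f m G φ else 0ℚ)
  collapse φ = begin
    ∑Maps p m (λ α → 𝟙 (eqFun (α ∘ δ) c) * (if eqFun (φ ∘ γ) α then f m G φ else 0ℚ))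
      ≡⟨ ∑-cong (allFuns p m) (λ α → move-test α (eqFun (φ ∘ γ) α) (eqFun-sym (φ ∘ γ) α)) ⟩
    ∑Maps p m (λ α → if eqFun α (φ ∘ γ) then 𝟙 (eqFun (α ∘ δ) c) * f m G φ else 0ℚ)
      ≡⟨ ∑Maps-delta p m (φ ∘ γ) (λ α → 𝟙 (eqFun (α ∘ δ) c) * f m G φ)
           (λ a b e → cong (λ z → 𝟙 z * f m G φ) (eqFun-resp {ψ = a ∘ δ} {b ∘ δ} (e ∘ δ) (λ _ → refl))) ⟩
    𝟙 (eqFun (φ ∘ γ ∘ δ) c) * f m G φ
      ≡⟨ sym (if-as-𝟙 (eqFun (φ ∘ γ ∘ δ) c) (f m G φ)) ⟩
    (if eqFun (φ ∘ (γ ∘ δ)) c then f m G φ else 0ℚ) ∎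
    where
    move-test : ∀ α b → b ≡ eqFun α (φ ∘ γ) →
                𝟙 (eqFun (α ∘ δ) c) * (if b then f m G φ else 0ℚ) ≡ (if eqFun α (φ ∘ γ) then 𝟙 (eqFun (α ∘ δ) c) * f m G φ else 0ℚ)
    move-test α true  e rewrite sym e = refl
    move-test α false e rewrite sym e = *-zeroʳ (𝟙 (eqFun (α ∘ δ) c))

inv : ℚ → ℚ
inv q with q ℚ.≟ 0ℚ
... | yes _   = 0ℚ
... | no q≢0 = 1/_ q {{≢-nonZero q≢0}}

divℚ-inv : ∀ p q → divℚ p q ≡ p * inv q
divℚ-inv p q with q ℚ.≟ 0ℚ
... | yes _ = sym (*-zeroʳ p)
... | no _  = refl

inv-cancel : ∀ x q → (q ≡ 0ℚ → x ≡ 0ℚ) → x * (inv q * q) ≡ x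
inv-cancel x q h with q ℚ.≟ 0ℚ
... | yes e  = trans (cong (x *_) (*-zeroˡ q)) (trans (*-zeroʳ x) (sym (h e)))
... | no q≢0 = trans (cong (x *_) (*-inverseˡ q {{≢-nonZero q≢0}})) (*-identityʳ x)

inv-nonneg : ∀ q → 0ℚ ≤ q → 0ℚ ≤ inv q
inv-nonneg q 0≤q with q ℚ.≟ 0ℚ
... | yes _   = ≤-refl
... | no q≢0 = nonNegative⁻¹ (1/_ q {{q≠0}}) {{pos⇒nonNeg (1/_ q {{q≠0}}) {{1/pos⇒pos q {{q>0}}}}}}
  where
  q≠0 = ≢-nonZero q≢0
  q>0 = nonNeg∧nonZero⇒pos q {{nonNegative 0≤q}} {{q≠0}}

*-nonneg : ∀ a b → 0ℚ ≤ a → 0ℚ ≤ b → 0ℚ ≤ a * b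
*-nonneg a b 0≤a 0≤b = nonNegative⁻¹ _ {{nonNeg*nonNeg⇒nonNeg a {{nonNegative 0≤a}} b {{nonNegative 0≤b}}}}

∑-nonneg : {A : Set} (l : List A) (F : A → ℚ) → (∀ x → 0ℚ ≤ F x) → 0ℚ ≤ ∑ l F
∑-nonneg []      F h = ≤-refl
∑-nonneg (x ∷ l) F h = ≤-trans (≤-reflexive (sym (+-identityʳ 0ℚ))) (+-mono-≤ (h x) (∑-nonneg l F h))

∑-mono : {A : Set} (l : List A) (F G : A → ℚ) → (∀ x → F x ≤ G x) → ∑ l F ≤ ∑ l G
∑-mono []      F G h = ≤-refl
∑-mono (x ∷ l) F G h = +-mono-≤ (h x) (∑-mono l F G h)

if-nonneg : ∀ b x → 0ℚ ≤ x → 0ℚ ≤ (if b then x else 0ℚ)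
if-nonneg true  x h = h
if-nonneg false x h = ≤-refl

restrict-nonneg : ∀ {n k} (f : Scheme k) (β : Fin n → Fin k) → NonNegativeScheme f → NonNegativeScheme (restrict f β)
restrict-nonneg {k = k} f β nn m G ψ = ∑-nonneg (allFuns k m) _ (λ φ → if-nonneg (eqFun (φ ∘ β) ψ) _ (nn m G φ))

≤-marginal : ∀ {n k} (f : Scheme k) → ExtensionalScheme f → NonNegativeScheme f → (β : Fin n → Fin k) → ∀ m G φ →
             f m G φ ≤ restrict f β m G (φ ∘ β)
≤-marginal {k = k} f ext nn β m G φ =
  ≤-trans (≤-reflexive (sym (∑Maps-delta k m φ (f m G) (ext m G)))) (∑-mono (allFuns k m) _ _ term)
  where
  term : ∀ ψ → (if eqFun ψ φ then f m G ψ else 0ℚ) ≤ (if eqFun (ψ ∘ β) (φ ∘ β) then f m G ψ else 0ℚ)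
  term ψ with eqFun ψ φ in e
  ... | true rewrite eqFun-complete (ψ ∘ β) (φ ∘ β) (λ i → eqFun-sound ψ φ e (β i)) = ≤-refl
  ... | false = if-nonneg (eqFun (ψ ∘ β) (φ ∘ β)) _ (nn m G ψ)

marginal-zero⇒zero : ∀ {n k} (f : Scheme k) → ExtensionalScheme f → NonNegativeScheme f → (β : Fin n → Fin k) →
                     ∀ m G φ → restrict f β m G (φ ∘ β) ≡ 0ℚ → f m G φ ≡ 0ℚ
marginal-zero⇒zero f ext nn β m G φ z =
  ≤-antisym (≤-trans (≤-marginal f ext nn β m G φ) (≤-reflexive z)) (nn m G φ)

all-cong : {A : Set} (l : List A) {p q : A → Bool} → (∀ x → p x ≡ q x) → all p l ≡ all q l
all-cong []      e = refl
all-cong (x ∷ l) e = cong₂ _∧_ (e x) (all-cong l e)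

isHom-resp : ∀ {k m} (H : Graph k) (G : Graph m) (φ φ' : Fin k → Fin m) → φ ≗ φ' → isHom H G φ ≡ isHom H G φ'
isHom-resp H G φ φ' e = all-cong (allFin _) (λ i → all-cong (allFin _)
  (λ j → cong₂ (λ a b → if adj H i j then adj G a b else true) (e i) (e j)))

recipℕ-nonneg : ∀ n → 0ℚ ≤ recipℕ n
recipℕ-nonneg zero    = ≤-refl
recipℕ-nonneg (suc n) = nonNegative⁻¹ _ {{normalize-nonNeg 1 (suc n)}}

coupled-ext : ∀ {k₁ k₂ n k} (f₁ : Scheme k₁) (f₂ : Scheme k₂) (β₁ : Fin n → Fin k₁) (ι₁ : Fin k₁ → Fin k) (ι₂ : Fin k₂ → Fin k) →
              ExtensionalScheme f₁ → ExtensionalScheme f₂ → ExtensionalScheme (coupled f₁ f₂ β₁ ι₁ ι₂)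
coupled-ext f₁ f₂ β₁ ι₁ ι₂ e₁ e₂ m G φ φ' e =
  cong₂ divℚ (cong₂ _*_ (e₁ m G _ _ (e ∘ ι₁)) (e₂ m G _ _ (e ∘ ι₂))) (restrict-resp f₁ β₁ m G _ _ (e ∘ ι₁ ∘ β₁))

coupled-nonneg : ∀ {k₁ k₂ n k} (f₁ : Scheme k₁) (f₂ : Scheme k₂) (β₁ : Fin n → Fin k₁) (ι₁ : Fin k₁ → Fin k) (ι₂ : Fin k₂ → Fin k) →
                 NonNegativeScheme f₁ → NonNegativeScheme f₂ → NonNegativeScheme (coupled f₁ f₂ β₁ ι₁ ι₂)
coupled-nonneg f₁ f₂ β₁ ι₁ ι₂ n₁ n₂ m G φ =
  ≤-trans (*-nonneg P (inv Q) (*-nonneg _ _ (n₁ m G (φ ∘ ι₁)) (n₂ m G (φ ∘ ι₂)))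
                              (inv-nonneg Q (restrict-nonneg f₁ β₁ n₁ m G (φ ∘ ι₁ ∘ β₁))))
          (≤-reflexive (sym (divℚ-inv P Q)))
  where
  P = f₁ m G (φ ∘ ι₁) * f₂ m G (φ ∘ ι₂)
  Q = restrict f₁ β₁ m G (φ ∘ ι₁ ∘ β₁)

𝔄-ext : ∀ {k} {H : Graph k} {f} → InA H f → ExtensionalScheme f
𝔄-ext base = λ m G φ φ' e →
  cong (λ b → if b then recipℕ (count (isHom edgeGraph G) (allFuns 2 m)) else 0ℚ) (isHom-resp edgeGraph G φ φ' e)
𝔄-ext (couple {f₁ = f₁} {f₂} a₁ a₂ β₁ _ _ _ _ _ ι₁ ι₂ _) = coupled-ext f₁ f₂ β₁ ι₁ ι₂ (𝔄-ext a₁) (𝔄-ext a₂)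

𝔄-nonneg : ∀ {k} {H : Graph k} {f} → InA H f → NonNegativeScheme f
𝔄-nonneg base = λ m G φ →
  if-nonneg (isHom edgeGraph G φ) _ (recipℕ-nonneg (count (isHom edgeGraph G) (allFuns 2 m)))
𝔄-nonneg (couple {f₁ = f₁} {f₂} a₁ a₂ β₁ _ _ _ _ _ ι₁ ι₂ _) = coupled-nonneg f₁ f₂ β₁ ι₁ ι₂ (𝔄-nonneg a₁) (𝔄-nonneg a₂)

-- Marginals of a coupled scheme

ℚ-ring : AlmostCommutativeRing 0ℓ 0ℓ
ℚ-ring = fromCommutativeRing +-*-commutativeRing (λ _ → nothing)

regroup-side₂ : ∀ c a x y i → c * (a * ((x * y) * i)) ≡ (a * x * i) * (c * y)
regroup-side₂ = solve-∀ ℚ-ring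

regroup-side₁ : ∀ a x y i → a * ((x * y) * i) ≡ (a * y * i) * x
regroup-side₁ = solve-∀ ℚ-ring

regroup-cancel : ∀ a x i u → (a * x * i) * u ≡ a * (x * (i * u))
regroup-cancel = solve-∀ ℚ-ring

regroup-glued : ∀ a b x y i → (a * b) * ((x * y) * i) ≡ ((a * x) * (b * y)) * i
regroup-glued = solve-∀ ℚ-ring

zero-factor : ∀ b z i j → z ≡ 0ℚ → b * (z * i) ≡ z * j
zero-factor b z i j refl = trans (cong (b *_) (*-zeroˡ i)) (trans (*-zeroʳ b) (sym (*-zeroˡ j)))

module CoupledMarginals {k₁ k₂ n k} {H₁ : Graph k₁} {H₂ : Graph k₂} {β₁ : Fin n → Fin k₁} {β₂ : Fin n → Fin k₂}
                        {H : Graph k} {ι₁ : Fin k₁ → Fin k} {ι₂ : Fin k₂ → Fin k}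
                        (CF : IsCoupledFrame H₁ H₂ β₁ β₂ H ι₁ ι₂)
                        (f₁ : Scheme k₁) (f₂ : Scheme k₂) (ext₁ : ExtensionalScheme f₁) (ext₂ : ExtensionalScheme f₂) where
  open GluedMaps CF

  f : Scheme k
  f = coupled f₁ f₂ β₁ ι₁ ι₂

  μ : ∀ m → Graph m → (Fin n → Fin m) → ℚ
  μ = restrict f₁ β₁

  weight : ∀ m → Graph m → (Fin k₁ → Fin m) → (Fin k₂ → Fin m) → ℚ
  weight m G φ₁ φ₂ = (f₁ m G φ₁ * f₂ m G φ₂) * inv (μ m G (φ₁ ∘ β₁))

  weight-ext : ∀ m G → Extensional₂ (weight m G)
  weight-ext m G φ₁ φ₁' φ₂ φ₂' e e' = cong₂ _*_ (cong₂ _*_ (ext₁ m G φ₁ φ₁' e) (ext₂ m G φ₂ φ₂' e'))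
    (cong inv (restrict-resp f₁ β₁ m G (φ₁ ∘ β₁) (φ₁' ∘ β₁) (e ∘ β₁)))

  restrict-coupled : ∀ m G {p} (γ : Fin p → Fin k) ψ →
                     restrict f γ m G ψ ≡ ∑Maps k m (λ φ → 𝟙 (eqFun (φ ∘ γ) ψ) * weight m G (φ ∘ ι₁) (φ ∘ ι₂))
  restrict-coupled m G γ ψ = ∑-cong (allFuns k m) (λ φ → trans (if-as-𝟙 (eqFun (φ ∘ γ) ψ) (f m G φ))
    (cong (𝟙 (eqFun (φ ∘ γ) ψ) *_) (divℚ-inv (f₁ m G (φ ∘ ι₁) * f₂ m G (φ ∘ ι₂)) (μ m G (φ ∘ ι₁ ∘ β₁)))))

  tested-ext : ∀ m G {p} (ψ : Fin p → Fin m) (σ : (Fin k₁ → Fin m) → (Fin k₂ → Fin m) → Fin p → Fin m) →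
               (∀ a a' b b' → a ≗ a' → b ≗ b' → σ a b ≗ σ a' b') →
               Extensional₂ (λ φ₁ φ₂ → 𝟙 (eqFun (σ φ₁ φ₂) ψ) * weight m G φ₁ φ₂)
  tested-ext m G ψ σ σ-resp a a' b b' e e' =
    cong₂ _*_ (cong 𝟙 (eqFun-resp (σ-resp a a' b b' e e') (λ _ → refl))) (weight-ext m G a a' b b' e e')

  Compatible : Set
  Compatible = restrict f₁ β₁ ≈S restrict f₂ β₂

  module _ (compat : Compatible) where

    integrate-side₂ : NonNegativeScheme f₁ → ∀ m G → HasEdge G → ∀ a φ₁ →
                      ∑Maps k₂ m (λ φ₂ → 𝟙 (compatible φ₁ φ₂) * (a * weight m G φ₁ φ₂)) ≡ a * f₁ m G φ₁
    integrate-side₂ nn₁ m G he a φ₁ = begin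
      ∑Maps k₂ m (λ φ₂ → 𝟙 (compatible φ₁ φ₂) * (a * weight m G φ₁ φ₂))
        ≡⟨ ∑-cong (allFuns k₂ m) (λ φ₂ → trans (regroup-side₂ (𝟙 (compatible φ₁ φ₂)) a X (f₂ m G φ₂) I)
             (cong (λ b → (a * X * I) * (𝟙 b * f₂ m G φ₂)) (eqFun-sym (φ₁ ∘ β₁) (φ₂ ∘ β₂)))) ⟩
      ∑Maps k₂ m (λ φ₂ → (a * X * I) * (𝟙 (eqFun (φ₂ ∘ β₂) c) * f₂ m G φ₂))
        ≡⟨ ∑-*ˡ (allFuns k₂ m) (a * X * I) _ ⟩
      (a * X * I) * ∑Maps k₂ m (λ φ₂ → 𝟙 (eqFun (φ₂ ∘ β₂) c) * f₂ m G φ₂)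
        ≡⟨ cong ((a * X * I) *_) (∑-cong (allFuns k₂ m) (λ φ₂ → sym (if-as-𝟙 (eqFun (φ₂ ∘ β₂) c) (f₂ m G φ₂)))) ⟩
      (a * X * I) * restrict f₂ β₂ m G c
        ≡⟨ cong ((a * X * I) *_) (sym (compat m G he c)) ⟩
      (a * X * I) * μ m G c
        ≡⟨ regroup-cancel a X I (μ m G c) ⟩
      a * (X * (I * μ m G c))
        ≡⟨ cong (a *_) (inv-cancel X (μ m G c) (marginal-zero⇒zero f₁ ext₁ nn₁ β₁ m G φ₁)) ⟩
      a * X ∎
      where
      X : ℚ
      X = f₁ m G φ₁
      c : Fin n → Fin m
      c = φ₁ ∘ β₁
      I : ℚ
      I = inv (μ m G c)

    integrate-side₁ : NonNegativeScheme f₂ → ∀ m G → HasEdge G → ∀ a φ₂ →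
                      ∑Maps k₁ m (λ φ₁ → 𝟙 (compatible φ₁ φ₂) * (a * weight m G φ₁ φ₂)) ≡ a * f₂ m G φ₂
    integrate-side₁ nn₂ m G he a φ₂ = begin
      ∑Maps k₁ m (λ φ₁ → 𝟙 (compatible φ₁ φ₂) * (a * weight m G φ₁ φ₂))
        ≡⟨ ∑-cong (allFuns k₁ m) term ⟩
      ∑Maps k₁ m (λ φ₁ → (a * Y * I) * (if compatible φ₁ φ₂ then f₁ m G φ₁ else 0ℚ))
        ≡⟨ ∑-*ˡ (allFuns k₁ m) (a * Y * I) _ ⟩
      (a * Y * I) * μ m G c
        ≡⟨ regroup-cancel a Y I (μ m G c) ⟩
      a * (Y * (I * μ m G c))
        ≡⟨ cong (a *_) (inv-cancel Y (μ m G c)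
             (λ z → marginal-zero⇒zero f₂ ext₂ nn₂ β₂ m G φ₂ (trans (sym (compat m G he c)) z))) ⟩
      a * Y ∎
      where
      Y : ℚ
      Y = f₂ m G φ₂
      c : Fin n → Fin m
      c = φ₂ ∘ β₂
      I : ℚ
      I = inv (μ m G c)
      -- only compatible φ₁ contribute, and for them the denominator is μ(c)
      term : ∀ φ₁ → 𝟙 (compatible φ₁ φ₂) * (a * weight m G φ₁ φ₂) ≡ (a * Y * I) * (if compatible φ₁ φ₂ then f₁ m G φ₁ else 0ℚ)
      term φ₁ with compatible φ₁ φ₂ in e
      ... | true  = begin
        1ℚ * (a * ((f₁ m G φ₁ * Y) * inv (μ m G (φ₁ ∘ β₁))))
          ≡⟨ *-identityˡ _ ⟩
        a * ((f₁ m G φ₁ * Y) * inv (μ m G (φ₁ ∘ β₁)))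
          ≡⟨ cong (λ z → a * ((f₁ m G φ₁ * Y) * inv z))
               (restrict-resp f₁ β₁ m G (φ₁ ∘ β₁) c (eqFun-sound (φ₁ ∘ β₁) c e)) ⟩
        a * ((f₁ m G φ₁ * Y) * I)
          ≡⟨ regroup-side₁ a (f₁ m G φ₁) Y I ⟩
        (a * Y * I) * f₁ m G φ₁ ∎
      ... | false = trans (*-zeroˡ (a * weight m G φ₁ φ₂)) (sym (*-zeroʳ (a * Y * I)))

    coupled-marginal₁ : NonNegativeScheme f₁ → ∀ {p} (γ : Fin p → Fin k₁) → restrict f (ι₁ ∘ γ) ≈S restrict f₁ γ
    coupled-marginal₁ nn₁ γ m G he ψ = begin
      restrict f (ι₁ ∘ γ) m G ψ
        ≡⟨ restrict-coupled m G (ι₁ ∘ γ) ψ ⟩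
      ∑Maps k m (λ φ → 𝟙 (eqFun (φ ∘ ι₁ ∘ γ) ψ) * weight m G (φ ∘ ι₁) (φ ∘ ι₂))
        ≡⟨ ∑-glued _ (tested-ext m G ψ (λ φ₁ _ → φ₁ ∘ γ) (λ a a' b b' e e' → e ∘ γ)) ⟩
      ∑Maps k₁ m (λ φ₁ → ∑Maps k₂ m (λ φ₂ → 𝟙 (compatible φ₁ φ₂) * (𝟙 (eqFun (φ₁ ∘ γ) ψ) * weight m G φ₁ φ₂)))
        ≡⟨ ∑-cong (allFuns k₁ m) (λ φ₁ → trans (integrate-side₂ nn₁ m G he (𝟙 (eqFun (φ₁ ∘ γ) ψ)) φ₁)
                                           (sym (if-as-𝟙 (eqFun (φ₁ ∘ γ) ψ) (f₁ m G φ₁)))) ⟩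
      restrict f₁ γ m G ψ ∎

    coupled-marginal₂ : NonNegativeScheme f₂ → ∀ {p} (γ : Fin p → Fin k₂) → restrict f (ι₂ ∘ γ) ≈S restrict f₂ γ
    coupled-marginal₂ nn₂ γ m G he ψ = begin
      restrict f (ι₂ ∘ γ) m G ψ
        ≡⟨ restrict-coupled m G (ι₂ ∘ γ) ψ ⟩
      ∑Maps k m (λ φ → 𝟙 (eqFun (φ ∘ ι₂ ∘ γ) ψ) * weight m G (φ ∘ ι₁) (φ ∘ ι₂))
        ≡⟨ ∑-glued _ (tested-ext m G ψ (λ _ φ₂ → φ₂ ∘ γ) (λ a a' b b' e e' → e' ∘ γ)) ⟩
      ∑Maps k₁ m (λ φ₁ → ∑Maps k₂ m (λ φ₂ → 𝟙 (compatible φ₁ φ₂) * (𝟙 (eqFun (φ₂ ∘ γ) ψ) * weight m G φ₁ φ₂)))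
        ≡⟨ ∑-swap (allFuns k₁ m) (allFuns k₂ m) _ ⟩
      ∑Maps k₂ m (λ φ₂ → ∑Maps k₁ m (λ φ₁ → 𝟙 (compatible φ₁ φ₂) * (𝟙 (eqFun (φ₂ ∘ γ) ψ) * weight m G φ₁ φ₂)))
        ≡⟨ ∑-cong (allFuns k₂ m) (λ φ₂ → trans (integrate-side₁ nn₂ m G he (𝟙 (eqFun (φ₂ ∘ γ) ψ)) φ₂)
                                           (sym (if-as-𝟙 (eqFun (φ₂ ∘ γ) ψ) (f₂ m G φ₂)))) ⟩
      restrict f₂ γ m G ψ ∎

  -- A part of V(H) glued from a part of V(H₁) (via γ₁) and a part of V(H₂)
  -- (via γ₂), both containing the interface (via δ₁, δ₂), along ι₁', ι₂'.
  record GluedPart (p p₁ p₂ : ℕ) : Set where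
    field
      γ       : Fin p → Fin k
      γ₁      : Fin p₁ → Fin k₁
      γ₂      : Fin p₂ → Fin k₂
      δ₁      : Fin n → Fin p₁
      δ₂      : Fin n → Fin p₂
      ι₁'     : Fin p₁ → Fin p
      ι₂'     : Fin p₂ → Fin p
      γ-ι₁    : ∀ x → γ (ι₁' x) ≡ ι₁ (γ₁ x)
      γ-ι₂    : ∀ y → γ (ι₂' y) ≡ ι₂ (γ₂ y)
      γ₁-δ₁   : ∀ j → γ₁ (δ₁ j) ≡ β₁ j
      γ₂-δ₂   : ∀ j → γ₂ (δ₂ j) ≡ β₂ j
      ι-δ     : ∀ j → ι₁' (δ₁ j) ≡ ι₂' (δ₂ j)
      ι-cover : ∀ i → (∃ λ x → ι₁' x ≡ i) ⊎ (∃ λ y → ι₂' y ≡ i)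

  module _ {p p₁ p₂} (P : GluedPart p p₁ p₂) (m : ℕ) (G : Graph m) (ψ : Fin p → Fin m) where
    open GluedPart P

    test₁ : (Fin k₁ → Fin m) → Bool
    test₁ φ₁ = eqFun (φ₁ ∘ γ₁) (ψ ∘ ι₁')

    test₂ : (Fin k₂ → Fin m) → Bool
    test₂ φ₂ = eqFun (φ₂ ∘ γ₂) (ψ ∘ ι₂')

    side₁ : (Fin k₁ → Fin m) → ℚ
    side₁ φ₁ = 𝟙 (test₁ φ₁) * f₁ m G φ₁

    side₂ : (Fin k₂ → Fin m) → ℚ
    side₂ φ₂ = 𝟙 (test₂ φ₂) * f₂ m G φ₂

    c : Fin n → Fin m
    c = ψ ∘ ι₁' ∘ δ₁

    test-split : ∀ φ → eqFun (φ ∘ γ) ψ ≡ test₁ (φ ∘ ι₁) ∧ test₂ (φ ∘ ι₂)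
    test-split φ = bool-ext
      (λ e → let u = eqFun-sound (φ ∘ γ) ψ e in ∧-intro
        (eqFun-complete (φ ∘ ι₁ ∘ γ₁) (ψ ∘ ι₁') (λ x → trans (cong φ (sym (γ-ι₁ x))) (u (ι₁' x))))
        (eqFun-complete (φ ∘ ι₂ ∘ γ₂) (ψ ∘ ι₂') (λ y → trans (cong φ (sym (γ-ι₂ y))) (u (ι₂' y)))))
      (λ e → let (e₁ , e₂) = ∧-split {test₁ (φ ∘ ι₁)} e in
        eqFun-complete (φ ∘ γ) ψ (λ i → on-part i (ι-cover i)
          (eqFun-sound (φ ∘ ι₁ ∘ γ₁) (ψ ∘ ι₁') e₁) (eqFun-sound (φ ∘ ι₂ ∘ γ₂) (ψ ∘ ι₂') e₂)))
      where
      on-part : ∀ i → (∃ λ x → ι₁' x ≡ i) ⊎ (∃ λ y → ι₂' y ≡ i) →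
                (∀ x → φ (ι₁ (γ₁ x)) ≡ ψ (ι₁' x)) → (∀ y → φ (ι₂ (γ₂ y)) ≡ ψ (ι₂' y)) → φ (γ i) ≡ ψ i
      on-part i (inj₁ (x , refl)) u₁ u₂ = trans (cong φ (γ-ι₁ x)) (u₁ x)
      on-part i (inj₂ (y , refl)) u₁ u₂ = trans (cong φ (γ-ι₂ y)) (u₂ y)

    tests-ext : Extensional₂ (λ φ₁ φ₂ → (𝟙 (test₁ φ₁) * 𝟙 (test₂ φ₂)) * weight m G φ₁ φ₂)
    tests-ext a a' b b' e e' = cong₂ _*_
      (cong₂ _*_ (cong 𝟙 (eqFun-resp {ψ = a ∘ γ₁} {a' ∘ γ₁} (e ∘ γ₁) (λ _ → refl)))
                 (cong 𝟙 (eqFun-resp {ψ = b ∘ γ₂} {b' ∘ γ₂} (e' ∘ γ₂) (λ _ → refl))))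
      (weight-ext m G a a' b b' e e')

    -- A pair passing both tests is compatible, with interface values c.
    gate : ∀ φ₁ φ₂ → 𝟙 (compatible φ₁ φ₂) * ((side₁ φ₁ * side₂ φ₂) * inv (μ m G (φ₁ ∘ β₁)))
                     ≡ (side₁ φ₁ * side₂ φ₂) * inv (μ m G c)
    gate φ₁ φ₂ = by-tests (test₁ φ₁) (test₂ φ₂) refl refl
      where
      Z : ℚ
      Z = side₁ φ₁ * side₂ φ₂
      by-tests : ∀ b₁ b₂ → test₁ φ₁ ≡ b₁ → test₂ φ₂ ≡ b₂ →
                 𝟙 (compatible φ₁ φ₂) * (Z * inv (μ m G (φ₁ ∘ β₁))) ≡ Z * inv (μ m G c)
      by-tests true true e₁ e₂ = begin
        𝟙 (compatible φ₁ φ₂) * (Z * inv (μ m G (φ₁ ∘ β₁)))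
          ≡⟨ cong₂ (λ b z → 𝟙 b * (Z * inv z)) agree (restrict-resp f₁ β₁ m G (φ₁ ∘ β₁) c on-c₁) ⟩
        1ℚ * (Z * inv (μ m G c))
          ≡⟨ *-identityˡ _ ⟩
        Z * inv (μ m G c) ∎
        where
        on-c₁ : ∀ j → φ₁ (β₁ j) ≡ c j
        on-c₁ j = trans (cong φ₁ (sym (γ₁-δ₁ j))) (eqFun-sound (φ₁ ∘ γ₁) (ψ ∘ ι₁') e₁ (δ₁ j))
        on-c₂ : ∀ j → φ₂ (β₂ j) ≡ c j
        on-c₂ j = trans (cong φ₂ (sym (γ₂-δ₂ j)))
                        (trans (eqFun-sound (φ₂ ∘ γ₂) (ψ ∘ ι₂') e₂ (δ₂ j)) (cong ψ (sym (ι-δ j))))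
        agree : compatible φ₁ φ₂ ≡ true
        agree = eqFun-complete (φ₁ ∘ β₁) (φ₂ ∘ β₂) (λ j → trans (on-c₁ j) (sym (on-c₂ j)))
      by-tests false _ e₁ _ = zero-factor (𝟙 (compatible φ₁ φ₂)) Z (inv (μ m G (φ₁ ∘ β₁))) (inv (μ m G c))
        (trans (cong (_* side₂ φ₂) (trans (cong (λ b → 𝟙 b * f₁ m G φ₁) e₁) (*-zeroˡ (f₁ m G φ₁))))
               (*-zeroˡ (side₂ φ₂)))
      by-tests true false _ e₂ = zero-factor (𝟙 (compatible φ₁ φ₂)) Z (inv (μ m G (φ₁ ∘ β₁))) (inv (μ m G c))
        (trans (cong (side₁ φ₁ *_) (trans (cong (λ b → 𝟙 b * f₂ m G φ₂) e₂) (*-zeroˡ (f₂ m G φ₂))))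
               (*-zeroʳ (side₁ φ₁)))

    coupled-marginal-glued : restrict f γ m G ψ ≡ coupled (restrict f₁ γ₁) (restrict f₂ γ₂) δ₁ ι₁' ι₂' m G ψ
    coupled-marginal-glued = begin
      restrict f γ m G ψ
        ≡⟨ restrict-coupled m G γ ψ ⟩
      ∑Maps k m (λ φ → 𝟙 (eqFun (φ ∘ γ) ψ) * weight m G (φ ∘ ι₁) (φ ∘ ι₂))
        ≡⟨ ∑-cong (allFuns k m) (λ φ → cong (_* weight m G (φ ∘ ι₁) (φ ∘ ι₂))
             (trans (cong 𝟙 (test-split φ)) (𝟙-∧ (test₁ (φ ∘ ι₁)) (test₂ (φ ∘ ι₂))))) ⟩
      ∑Maps k m (λ φ → (𝟙 (test₁ (φ ∘ ι₁)) * 𝟙 (test₂ (φ ∘ ι₂))) * weight m G (φ ∘ ι₁) (φ ∘ ι₂))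
        ≡⟨ ∑-glued (λ φ₁ φ₂ → (𝟙 (test₁ φ₁) * 𝟙 (test₂ φ₂)) * weight m G φ₁ φ₂) tests-ext ⟩
      ∑Maps k₁ m (λ φ₁ → ∑Maps k₂ m (λ φ₂ → 𝟙 (compatible φ₁ φ₂) * ((𝟙 (test₁ φ₁) * 𝟙 (test₂ φ₂)) * weight m G φ₁ φ₂)))
        ≡⟨ ∑-cong (allFuns k₁ m) (λ φ₁ → ∑-cong (allFuns k₂ m) (λ φ₂ →
             trans (cong (𝟙 (compatible φ₁ φ₂) *_) (regroup-glued (𝟙 (test₁ φ₁)) (𝟙 (test₂ φ₂)) (f₁ m G φ₁) (f₂ m G φ₂)
                                                                  (inv (μ m G (φ₁ ∘ β₁)))))
                   (gate φ₁ φ₂))) ⟩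
      ∑Maps k₁ m (λ φ₁ → ∑Maps k₂ m (λ φ₂ → (side₁ φ₁ * side₂ φ₂) * I))
        ≡⟨ ∑-cong (allFuns k₁ m) (λ φ₁ → trans (∑-*ʳ (allFuns k₂ m) I (λ φ₂ → side₁ φ₁ * side₂ φ₂))
             (cong (_* I) (∑-*ˡ (allFuns k₂ m) (side₁ φ₁) side₂))) ⟩
      ∑Maps k₁ m (λ φ₁ → (side₁ φ₁ * ∑Maps k₂ m side₂) * I)
        ≡⟨ trans (∑-*ʳ (allFuns k₁ m) I (λ φ₁ → side₁ φ₁ * ∑Maps k₂ m side₂)) (cong (_* I) (∑-*ʳ (allFuns k₁ m) (∑Maps k₂ m side₂) side₁)) ⟩
      (∑Maps k₁ m side₁ * ∑Maps k₂ m side₂) * I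
        ≡⟨ cong₂ (λ u v → (u * v) * I)
             (∑-cong (allFuns k₁ m) (λ φ₁ → sym (if-as-𝟙 (test₁ φ₁) (f₁ m G φ₁))))
             (∑-cong (allFuns k₂ m) (λ φ₂ → sym (if-as-𝟙 (test₂ φ₂) (f₂ m G φ₂)))) ⟩
      (restrict f₁ γ₁ m G (ψ ∘ ι₁') * restrict f₂ γ₂ m G (ψ ∘ ι₂')) * I
        ≡⟨ cong (λ z → (restrict f₁ γ₁ m G (ψ ∘ ι₁') * restrict f₂ γ₂ m G (ψ ∘ ι₂')) * inv z)
             (sym (trans (restrict-restrict f₁ γ₁ δ₁ m G c) (restrict-cong-β f₁ γ₁-δ₁ m G c))) ⟩
      (restrict f₁ γ₁ m G (ψ ∘ ι₁') * restrict f₂ γ₂ m G (ψ ∘ ι₂')) * inv (restrict (restrict f₁ γ₁) δ₁ m G c)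
        ≡⟨ sym (divℚ-inv (restrict f₁ γ₁ m G (ψ ∘ ι₁') * restrict f₂ γ₂ m G (ψ ∘ ι₂'))
                         (restrict (restrict f₁ γ₁) δ₁ m G c)) ⟩
      coupled (restrict f₁ γ₁) (restrict f₂ γ₂) δ₁ ι₁' ι₂' m G ψ ∎
      where
      I : ℚ
      I = inv (μ m G c)

-- Gluing two graphs along injections

∨-split : ∀ {a b} → a ∨ b ≡ true → a ≡ true ⊎ b ≡ true
∨-split {true}  _ = inj₁ refl
∨-split {false} e = inj₂ e

∨-introˡ : ∀ {a} b → a ≡ true → a ∨ b ≡ true
∨-introˡ b refl = refl

∨-introʳ : ∀ a {b} → b ≡ true → a ∨ b ≡ true
∨-introʳ true  _ = refl
∨-introʳ false e = e

EdgeImage : ∀ {k₁ k₂ k} (H₁ : Graph k₁) (H₂ : Graph k₂) (ι₁ : Fin k₁ → Fin k) (ι₂ : Fin k₂ → Fin k) → Fin k → Fin k → Set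
EdgeImage H₁ H₂ ι₁ ι₂ u w = (∃₂ λ x y → adj H₁ x y ≡ true × ι₁ x ≡ u × ι₁ y ≡ w)
                          ⊎ (∃₂ λ x y → adj H₂ x y ≡ true × ι₂ x ≡ u × ι₂ y ≡ w)

EdgeImage-sym : ∀ {k₁ k₂ k} (H₁ : Graph k₁) (H₂ : Graph k₂) (ι₁ : Fin k₁ → Fin k) (ι₂ : Fin k₂ → Fin k) {u w} →
                EdgeImage H₁ H₂ ι₁ ι₂ u w → EdgeImage H₁ H₂ ι₁ ι₂ w u
EdgeImage-sym H₁ H₂ ι₁ ι₂ (inj₁ (x , y , a , ex , ey)) = inj₁ (y , x , trans (Graph.sym H₁ y x) a , ey , ex)
EdgeImage-sym H₁ H₂ ι₁ ι₂ (inj₂ (x , y , a , ex , ey)) = inj₂ (y , x , trans (Graph.sym H₂ y x) a , ey , ex)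

imageAdj : ∀ {k₁ k} (H₁ : Graph k₁) (ι₁ : Fin k₁ → Fin k) → Fin k → Fin k → Bool
imageAdj {k₁} H₁ ι₁ u w =
  any (λ x → any (λ y → adj H₁ x y ∧ (does (ι₁ x ≟ u) ∧ does (ι₁ y ≟ w))) (allFin k₁)) (allFin k₁)

imageAdj-iff : ∀ {k₁ k} (H₁ : Graph k₁) (ι₁ : Fin k₁ → Fin k) u w →
               (imageAdj H₁ ι₁ u w ≡ true) ⇔ (∃₂ λ x y → adj H₁ x y ≡ true × ι₁ x ≡ u × ι₁ y ≡ w)
imageAdj-iff {k₁} H₁ ι₁ u w = mk⇔ to from
  where
  to : imageAdj H₁ ι₁ u w ≡ true → ∃₂ λ x y → adj H₁ x y ≡ true × ι₁ x ≡ u × ι₁ y ≡ w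
  to e with any-allFin⁻ k₁ _ e
  ... | x , ex with any-allFin⁻ k₁ _ ex
  ... | y , ey with ∧-split {adj H₁ x y} ey
  ... | a , b with ∧-split {does (ι₁ x ≟ u)} b
  ... | c , d = x , y , a , does-true c , does-true d
  from : (∃₂ λ x y → adj H₁ x y ≡ true × ι₁ x ≡ u × ι₁ y ≡ w) → imageAdj H₁ ι₁ u w ≡ true
  from (x , y , a , c , d) = any-allFin⁺ k₁ _ x (any-allFin⁺ k₁ _ y
    (∧-intro a (∧-intro (dec-true (ι₁ x ≟ u) c) (dec-true (ι₁ y ≟ w) d))))

glueAdj : ∀ {k₁ k₂ k} (H₁ : Graph k₁) (H₂ : Graph k₂) (ι₁ : Fin k₁ → Fin k) (ι₂ : Fin k₂ → Fin k) → Fin k → Fin k → Bool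
glueAdj H₁ H₂ ι₁ ι₂ u w = imageAdj H₁ ι₁ u w ∨ imageAdj H₂ ι₂ u w

glueAdj-iff : ∀ {k₁ k₂ k} (H₁ : Graph k₁) (H₂ : Graph k₂) (ι₁ : Fin k₁ → Fin k) (ι₂ : Fin k₂ → Fin k) u w →
              (glueAdj H₁ H₂ ι₁ ι₂ u w ≡ true) ⇔ EdgeImage H₁ H₂ ι₁ ι₂ u w
glueAdj-iff H₁ H₂ ι₁ ι₂ u w = mk⇔ to from
  where
  to : glueAdj H₁ H₂ ι₁ ι₂ u w ≡ true → EdgeImage H₁ H₂ ι₁ ι₂ u w
  to e with ∨-split {imageAdj H₁ ι₁ u w} e
  ... | inj₁ a = inj₁ (Equivalence.to (imageAdj-iff H₁ ι₁ u w) a)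
  ... | inj₂ b = inj₂ (Equivalence.to (imageAdj-iff H₂ ι₂ u w) b)
  from : EdgeImage H₁ H₂ ι₁ ι₂ u w → glueAdj H₁ H₂ ι₁ ι₂ u w ≡ true
  from (inj₁ r) = ∨-introˡ (imageAdj H₂ ι₂ u w) (Equivalence.from (imageAdj-iff H₁ ι₁ u w) r)
  from (inj₂ r) = ∨-introʳ (imageAdj H₁ ι₁ u w) (Equivalence.from (imageAdj-iff H₂ ι₂ u w) r)

glueGraph : ∀ {k₁ k₂ k} (H₁ : Graph k₁) (H₂ : Graph k₂) (ι₁ : Fin k₁ → Fin k) (ι₂ : Fin k₂ → Fin k) →
            Injective ι₁ → Injective ι₂ → Graph k
glueGraph H₁ H₂ ι₁ ι₂ ι₁-inj ι₂-inj = record { adj = glueAdj H₁ H₂ ι₁ ι₂ ; sym = symmetric ; irrefl = loopless }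
  where
  iff : ∀ u w → (glueAdj H₁ H₂ ι₁ ι₂ u w ≡ true) ⇔ EdgeImage H₁ H₂ ι₁ ι₂ u w
  iff = glueAdj-iff H₁ H₂ ι₁ ι₂
  symmetric : ∀ u w → glueAdj H₁ H₂ ι₁ ι₂ u w ≡ glueAdj H₁ H₂ ι₁ ι₂ w u
  symmetric u w = bool-ext
    (λ e → Equivalence.from (iff w u) (EdgeImage-sym H₁ H₂ ι₁ ι₂ (Equivalence.to (iff u w) e)))
    (λ e → Equivalence.from (iff u w) (EdgeImage-sym H₁ H₂ ι₁ ι₂ (Equivalence.to (iff w u) e)))
  no-loop : ∀ {u} → EdgeImage H₁ H₂ ι₁ ι₂ u u → ⊥
  no-loop (inj₁ (x , y , a , ex , ey)) with ι₁-inj (trans ex (sym ey))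
  ... | refl with trans (sym a) (irrefl H₁ x)
  ... | ()
  no-loop (inj₂ (x , y , a , ex , ey)) with ι₂-inj (trans ex (sym ey))
  ... | refl with trans (sym a) (irrefl H₂ x)
  ... | ()
  loopless : ∀ u → glueAdj H₁ H₂ ι₁ ι₂ u u ≡ false
  loopless u = ≢true⇒≡false (λ e → no-loop (Equivalence.to (iff u u) e))

glueFrame : ∀ {k₁ k₂ n k} {H₁ : Graph k₁} {H₂ : Graph k₂} {β₁ : Fin n → Fin k₁} {β₂ : Fin n → Fin k₂}
              {ι₁ : Fin k₁ → Fin k} {ι₂ : Fin k₂ → Fin k} (ι₁-inj : Injective ι₁) (ι₂-inj : Injective ι₂) →
            (∀ x y → (ι₁ x ≡ ι₂ y) ⇔ (∃ λ j → β₁ j ≡ x × β₂ j ≡ y)) →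
            (∀ w → (∃ λ x → ι₁ x ≡ w) ⊎ (∃ λ y → ι₂ y ≡ w)) →
            IsCoupledFrame H₁ H₂ β₁ β₂ (glueGraph H₁ H₂ ι₁ ι₂ ι₁-inj ι₂-inj) ι₁ ι₂
glueFrame {H₁ = H₁} {H₂} {ι₁ = ι₁} {ι₂} ι₁-inj ι₂-inj glue cover = record
  { inj₁ = ι₁-inj ; inj₂ = ι₂-inj ; glue = glue ; cover = cover ; edges = glueAdj-iff H₁ H₂ ι₁ ι₂ }

record Enumeration {v : ℕ} (P : Fin v → Set) : Set where
  field
    size : ℕ
    e    : Fin size → Fin v
    inj  : Injective e
    into : ∀ i → P (e i)
    onto : ∀ x → P x → ∃ λ i → e i ≡ x

  index : ∀ x → P x → Fin size
  index x h = proj₁ (onto x h)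

  index-eq : ∀ x h → e (index x h) ≡ x
  index-eq x h = proj₂ (onto x h)

  index-inj : ∀ {n} (χ : Fin n → Fin v) (h : ∀ j → P (χ j)) → Injective χ → Injective (λ j → index (χ j) (h j))
  index-inj χ h χ-inj {a} {b} q =
    χ-inj (trans (sym (index-eq (χ a) (h a))) (trans (cong e q) (index-eq (χ b) (h b))))

enumerate : ∀ {v} (P : Fin v → Set) → (∀ x → Dec (P x)) → Enumeration P
enumerate {zero} P d = record { size = 0 ; e = λ () ; inj = λ {x} → ⊥-elim (no-fin x) ; into = λ () ; onto = λ () }
  where
  no-fin : Fin 0 → ⊥
  no-fin ()
enumerate {suc v} P d with enumerate (P ∘ suc) (d ∘ suc) | d zero
... | r | yes p0 = record { size = suc (Enumeration.size r) ; e = e' ; inj = λ {a} {b} → inj' a b ; into = into' ; onto = onto' }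
  where
  e' : Fin (suc (Enumeration.size r)) → Fin (suc v)
  e' zero    = zero
  e' (suc i) = suc (Enumeration.e r i)
  inj' : ∀ a b → e' a ≡ e' b → a ≡ b
  inj' zero    zero    _ = refl
  inj' (suc a) (suc b) q = cong suc (Enumeration.inj r (suc-injective q))
  into' : ∀ i → P (e' i)
  into' zero    = p0
  into' (suc i) = Enumeration.into r i
  onto' : ∀ x → P x → ∃ λ i → e' i ≡ x
  onto' zero    _  = zero , refl
  onto' (suc x) px with Enumeration.onto r x px
  ... | i , q = suc i , cong suc q
... | r | no ¬p0 = record { size = Enumeration.size r ; e = suc ∘ Enumeration.e r
                          ; inj = λ q → Enumeration.inj r (suc-injective q) ; into = Enumeration.into r ; onto = onto' }
  where
  onto' : ∀ x → P x → ∃ λ i → suc (Enumeration.e r i) ≡ x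
  onto' zero    p  = ⊥-elim (¬p0 p)
  onto' (suc x) px with Enumeration.onto r x px
  ... | i , q = i , cong suc q

enumerateSubset : ∀ {v} (K : Subset v) → Enumeration (_∈ K)
enumerateSubset K = enumerate (_∈ K) (_∈? K)

∈-image⁻ : ∀ {v v'} (f : Fin v → Fin v') (K : Subset v) y → y ∈ image f K → ∃ λ x → x ∈ K × f x ≡ y
∈-image⁻ {v} f K y h with any-allFin⁻ v _ (trans (sym (lookup∘tabulate _ y)) ([]=⇒lookup h))
... | x , e with ∧-split {lookup K x} e
... | a , b = x , lookup⇒[]= x K a , does-true b

∈-image⁺ : ∀ {v v'} (f : Fin v → Fin v') (K : Subset v) x → x ∈ K → f x ∈ image f K
∈-image⁺ {v} f K x h = lookup⇒[]= (f x) (image f K) (trans (lookup∘tabulate _ (f x))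
  (any-allFin⁺ v _ x (∧-intro ([]=⇒lookup h) (dec-true (f x ≟ f x) refl))))

∈-pair⁻ : ∀ {v} (a b z : Fin v) → z ∈ ⁅ a ⁆ ∪ ⁅ b ⁆ → z ≡ a ⊎ z ≡ b
∈-pair⁻ a b z h with x∈p∪q⁻ ⁅ a ⁆ ⁅ b ⁆ h
... | inj₁ p = inj₁ (x∈⁅y⁆⇒x≡y a p)
... | inj₂ q = inj₂ (x∈⁅y⁆⇒x≡y b q)

∈-pairˡ : ∀ {v} (a b : Fin v) → a ∈ ⁅ a ⁆ ∪ ⁅ b ⁆
∈-pairˡ a b = x∈p∪q⁺ (inj₁ (x∈⁅x⁆ a))

∈-pairʳ : ∀ {v} (a b : Fin v) → b ∈ ⁅ a ⁆ ∪ ⁅ b ⁆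
∈-pairʳ a b = x∈p∪q⁺ (inj₂ (x∈⁅x⁆ b))

pair⊆ : ∀ {v} {x y : Fin v} {K : Subset v} → x ∈ K → y ∈ K → ⁅ x ⁆ ∪ ⁅ y ⁆ ⊆ K
pair⊆ {x = x} {y} hx hy {z} h with ∈-pair⁻ x y z h
... | inj₁ refl = hx
... | inj₂ refl = hy

image-pair : ∀ {v v'} (f : Fin v → Fin v') (a b : Fin v) → image f (⁅ a ⁆ ∪ ⁅ b ⁆) ≡ ⁅ f a ⁆ ∪ ⁅ f b ⁆
image-pair f a b = ⊆-antisym image⊆ (pair⊆ (∈-image⁺ f _ a (∈-pairˡ a b)) (∈-image⁺ f _ b (∈-pairʳ a b)))
  where
  image⊆ : image f (⁅ a ⁆ ∪ ⁅ b ⁆) ⊆ ⁅ f a ⁆ ∪ ⁅ f b ⁆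
  image⊆ {z} h with ∈-image⁻ f _ z h
  ... | x , hx , refl with ∈-pair⁻ a b x hx
  ... | inj₁ refl = ∈-pairˡ (f a) (f b)
  ... | inj₂ refl = ∈-pairʳ (f a) (f b)

pair-preimage : ∀ {v v'} (K : Subset v) (t : Fin v → Fin v') {u w : Fin v'} →
                (∀ x y → x ∈ K → y ∈ K → t x ≡ t y → x ≡ y) →
                (∀ z → z ∈ K → t z ≡ u ⊎ t z ≡ w) →
                ∀ x y → x ∈ K → y ∈ K → t x ≡ u → t y ≡ w → K ≡ ⁅ x ⁆ ∪ ⁅ y ⁆
pair-preimage K t t-inj into x y hx hy ex ey = ⊆-antisym K⊆pair (pair⊆ hx hy)
  where
  K⊆pair : K ⊆ ⁅ x ⁆ ∪ ⁅ y ⁆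
  K⊆pair {z} hz with into z hz
  ... | inj₁ e = x∈p∪q⁺ (inj₁ (subst (_∈ ⁅ x ⁆) (sym (t-inj z x hz hx (trans e (sym ex)))) (x∈⁅x⁆ x)))
  ... | inj₂ e = x∈p∪q⁺ (inj₂ (subst (_∈ ⁅ y ⁆) (sym (t-inj z y hz hy (trans e (sym ey)))) (x∈⁅x⁆ y)))

-- The invariant

record EdgeScheme {v} (E : Subset v → Set) (f : Scheme v) (K : Subset v) : Set where
  field
    vertices : Enumeration (_∈ K)
  open Enumeration vertices public
  field
    frame     : Graph size
    frame-adj : ∀ i j → (adj frame i j ≡ true) ⇔ FrameAdj E (e i) (e j)
    g         : Scheme size
    g-𝔄       : InA frame g
    marginal  : restrict f e ≈S g

edge-marginal : ∀ {v E f K} (P : EdgeScheme {v} E f K) → ∀ {q} (h : Fin q → Fin (EdgeScheme.size P)) →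
                restrict (EdgeScheme.g P) h ≈S restrict f (EdgeScheme.e P ∘ h)
edge-marginal {f = f} P h m G he ψ =
  trans (sym (restrict-≈ h (EdgeScheme.marginal P) m G he ψ)) (restrict-restrict f (EdgeScheme.e P) h m G ψ)

record FrameInvariant (v : ℕ) (E : Subset v → Set) : Set where
  field
    frame     : Graph v
    frame-adj : ∀ u w → (adj frame u w ≡ true) ⇔ FrameAdj E u w
    f         : Scheme v
    f-𝔄       : InA frame f
    edge      : ∀ K → E K → EdgeScheme E f K
    two       : ∀ K → E K → ∃₂ λ a b → a ≢ b × a ∈ K × b ∈ K

edge-frame-adj : ∀ u w → (adj edgeGraph u w ≡ true) ⇔ FrameAdj (λ K → K ≡ full) u w
edge-frame-adj zero       zero       = mk⇔ (λ ()) (λ fa → ⊥-elim (proj₁ fa refl))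
edge-frame-adj zero       (suc zero) = mk⇔ (λ _ → (λ ()) , refl) (λ _ → refl)
edge-frame-adj (suc zero) zero       = mk⇔ (λ _ → (λ ()) , refl) (λ _ → refl)
edge-frame-adj (suc zero) (suc zero) = mk⇔ (λ ()) (λ fa → ⊥-elim (proj₁ fa refl))

start-invariant : FrameInvariant 2 (λ K → K ≡ full)
start-invariant = record
  { frame = edgeGraph ; frame-adj = edge-frame-adj ; f = τe ; f-𝔄 = base
  ; edge = λ { K refl → record
      { vertices = record { size = 2 ; e = id ; inj = id ; into = λ _ → ∈⊤ ; onto = λ x _ → x , refl }
      ; frame = edgeGraph ; frame-adj = edge-frame-adj ; g = τe ; g-𝔄 = base
      ; marginal = λ m G _ ψ → restrict-id τe (𝔄-ext base) m G ψ } }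
  ; two = λ { K refl → zero , suc zero , (λ ()) , ∈⊤ , ∈⊤ } }

-- A reflection preserves the invariant

module Reflection {v v' : ℕ} {E : Subset v → Set} (I : FrameInvariant v E) (L X : Subset v) (EL : E L) (X⊆L : X ⊆ L)
                  (τ₁ τ₂ : Fin v → Fin v') (RV : IsReflectionVertexSet L X τ₁ τ₂) where
  open FrameInvariant I
  module RV = IsReflectionVertexSet RV

  E' : Subset v' → Set
  E' = reflE E L X τ₁ τ₂

  τ-agree : ∀ x → x ∈ X → τ₁ x ≡ τ₂ x
  τ-agree x h = Equivalence.from (RV.glue x x (X⊆L h)) (refl , h)

  τ-meet : ∀ x y → y ∈ L → τ₁ x ≡ τ₂ y → x ≡ y × x ∈ X
  τ-meet x y hy = Equivalence.to (RV.glue x y hy)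

  Copy₁ Copy₂ : Fin v' → Fin v' → Set
  Copy₁ u w = ∃₂ λ x y → FrameAdj E x y × τ₁ x ≡ u × τ₁ y ≡ w
  Copy₂ u w = ∃₂ λ x y → x ∈ L × y ∈ L × FrameAdj E x y × τ₂ x ≡ u × τ₂ y ≡ w

  copy⇒frame-edge : ∀ {u w} → Copy₁ u w ⊎ Copy₂ u w → FrameAdj E' u w
  copy⇒frame-edge (inj₁ (x , y , (x≢y , EK) , refl , refl)) =
    (λ q → x≢y (RV.inj₁ q)) , inj₁ (⁅ x ⁆ ∪ ⁅ y ⁆ , EK , sym (image-pair τ₁ x y))
  copy⇒frame-edge (inj₂ (x , y , hx , hy , (x≢y , EK) , refl , refl)) =
    (λ q → x≢y (RV.inj₂ x y hx hy q)) , inj₂ (inj₁ (⁅ x ⁆ ∪ ⁅ y ⁆ , EK , pair⊆ hx hy , sym (image-pair τ₂ x y)))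

  frame-edge-of-image : ∀ {u w} (K : Subset v) (t : Fin v → Fin v') → (∀ x y → x ∈ K → y ∈ K → t x ≡ t y → x ≡ y) →
                        E K → u ≢ w → (∀ z → z ∈ K → t z ≡ u ⊎ t z ≡ w) → ∀ x y → x ∈ K → y ∈ K → t x ≡ u → t y ≡ w →
                        FrameAdj E x y
  frame-edge-of-image K t t-inj EK u≢w into x y hx hy ex ey =
    (λ q → u≢w (trans (sym ex) (trans (cong t q) ey))) , subst E (pair-preimage K t t-inj into x y hx hy ex ey) EK

  image-into-pair : ∀ {u w} (K : Subset v) (t : Fin v → Fin v') → ⁅ u ⁆ ∪ ⁅ w ⁆ ≡ image t K →
                    ∀ z → z ∈ K → t z ≡ u ⊎ t z ≡ w
  image-into-pair {u} {w} K t eq z hz = ∈-pair⁻ u w (t z) (subst (t z ∈_) (sym eq) (∈-image⁺ t K z hz))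

  copy-of-image : ∀ {u w} (K : Subset v) (t : Fin v → Fin v') → (∀ x y → x ∈ K → y ∈ K → t x ≡ t y → x ≡ y) →
                  E K → u ≢ w → ⁅ u ⁆ ∪ ⁅ w ⁆ ≡ image t K →
                  ∃₂ λ x y → x ∈ K × y ∈ K × FrameAdj E x y × t x ≡ u × t y ≡ w
  copy-of-image {u} {w} K t t-inj EK u≢w eq with ∈-image⁻ t K u (subst (u ∈_) eq (∈-pairˡ u w))
                                             | ∈-image⁻ t K w (subst (w ∈_) eq (∈-pairʳ u w))
  ... | x , hx , ex | y , hy , ey =
    x , y , hx , hy , frame-edge-of-image K t t-inj EK u≢w (image-into-pair K t eq) x y hx hy ex ey , ex , ey

  -- An edge of the third kind has only two vertices if it is τ₁ K₁ with K₁ a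
  -- two-element edge (K₁ has two distinct vertices, both mapped into {u, w}).
  copy-of-glued : ∀ {u w} K₁ K₂ → E K₁ → u ≢ w → ⁅ u ⁆ ∪ ⁅ w ⁆ ≡ image τ₁ K₁ ∪ image τ₂ K₂ → Copy₁ u w
  copy-of-glued {u} {w} K₁ K₂ EK₁ u≢w eq with two K₁ EK₁
  ... | a , b , a≢b , ha , hb = by-sides (into a ha) (into b hb)
    where
    into : ∀ z → z ∈ K₁ → τ₁ z ≡ u ⊎ τ₁ z ≡ w
    into z hz = ∈-pair⁻ u w (τ₁ z) (subst (τ₁ z ∈_) (sym eq) (x∈p∪q⁺ (inj₁ (∈-image⁺ τ₁ K₁ z hz))))
    copy : ∀ x y → x ∈ K₁ → y ∈ K₁ → τ₁ x ≡ u → τ₁ y ≡ w → Copy₁ u w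
    copy x y hx hy ex ey = x , y , frame-edge-of-image K₁ τ₁ (λ _ _ _ _ → RV.inj₁) EK₁ u≢w into x y hx hy ex ey , ex , ey
    by-sides : (τ₁ a ≡ u ⊎ τ₁ a ≡ w) → (τ₁ b ≡ u ⊎ τ₁ b ≡ w) → Copy₁ u w
    by-sides (inj₁ ea) (inj₂ eb) = copy a b ha hb ea eb
    by-sides (inj₂ ea) (inj₁ eb) = copy b a hb ha eb ea
    by-sides (inj₁ ea) (inj₁ eb) = ⊥-elim (a≢b (RV.inj₁ (trans ea (sym eb))))
    by-sides (inj₂ ea) (inj₂ eb) = ⊥-elim (a≢b (RV.inj₁ (trans ea (sym eb))))

  frame-edge⇒copy : ∀ {u w} → FrameAdj E' u w → Copy₁ u w ⊎ Copy₂ u w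
  frame-edge⇒copy (u≢w , inj₁ (K , EK , eq)) with copy-of-image K τ₁ (λ _ _ _ _ → RV.inj₁) EK u≢w eq
  ... | x , y , _ , _ , fa , ex , ey = inj₁ (x , y , fa , ex , ey)
  frame-edge⇒copy (u≢w , inj₂ (inj₁ (K , EK , K⊆L , eq)))
    with copy-of-image K τ₂ (λ x y hx hy → RV.inj₂ x y (K⊆L hx) (K⊆L hy)) EK u≢w eq
  ... | x , y , hx , hy , fa , ex , ey = inj₂ (x , y , K⊆L hx , K⊆L hy , fa , ex , ey)
  frame-edge⇒copy (u≢w , inj₂ (inj₂ (K₁ , K₂ , (EK₁ , _) , eq))) = inj₁ (copy-of-glued K₁ K₂ EK₁ u≢w eq)

  frame-edge-τ₁ : ∀ a b → FrameAdj E' (τ₁ a) (τ₁ b) ⇔ FrameAdj E a b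
  frame-edge-τ₁ a b = mk⇔ to (λ fa → copy⇒frame-edge (inj₁ (a , b , fa , refl , refl)))
    where
    to : FrameAdj E' (τ₁ a) (τ₁ b) → FrameAdj E a b
    to fa with frame-edge⇒copy fa
    ... | inj₁ (x , y , fa' , ex , ey) with RV.inj₁ ex | RV.inj₁ ey
    ... | refl | refl = fa'
    to fa | inj₂ (x , y , hx , hy , fa' , ex , ey) with proj₁ (τ-meet a x hx (sym ex)) | proj₁ (τ-meet b y hy (sym ey))
    ... | refl | refl = fa'

  frame-edge-τ₂ : ∀ a b → a ∈ L → b ∈ L → FrameAdj E' (τ₂ a) (τ₂ b) ⇔ FrameAdj E a b
  frame-edge-τ₂ a b ha hb = mk⇔ to (λ fa → copy⇒frame-edge (inj₂ (a , b , ha , hb , fa , refl , refl)))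
    where
    to : FrameAdj E' (τ₂ a) (τ₂ b) → FrameAdj E a b
    to fa with frame-edge⇒copy fa
    ... | inj₁ (x , y , fa' , ex , ey) with proj₁ (τ-meet x a ha ex) | proj₁ (τ-meet y b hb ey)
    ... | refl | refl = fa'
    to fa | inj₂ (x , y , hx , hy , fa' , ex , ey) with RV.inj₂ x a hx ha ex | RV.inj₂ y b hy hb ey
    ... | refl | refl = fa'

  -- The new frame glues F(N) and the frame of L along X, and the new
  -- scheme is the coupling f' = C(f, g_L) along X.
  module g_L = EdgeScheme (edge L EL)
  module EX = Enumeration (enumerateSubset X)

  χ : Fin EX.size → Fin v
  χ = EX.e

  χ-L : ∀ j → χ j ∈ L
  χ-L j = X⊆L (EX.into j)

  β₂ : Fin EX.size → Fin g_L.size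
  β₂ j = g_L.index (χ j) (χ-L j)

  ι₂ : Fin g_L.size → Fin v'
  ι₂ = τ₂ ∘ g_L.e

  ι₂-inj : Injective ι₂
  ι₂-inj {a} {b} q = g_L.inj (RV.inj₂ (g_L.e a) (g_L.e b) (g_L.into a) (g_L.into b) q)

  glue-X : ∀ x y → (τ₁ x ≡ ι₂ y) ⇔ (∃ λ j → χ j ≡ x × β₂ j ≡ y)
  glue-X x y = mk⇔ to from
    where
    to : τ₁ x ≡ ι₂ y → ∃ λ j → χ j ≡ x × β₂ j ≡ y
    to q with τ-meet x (g_L.e y) (g_L.into y) q
    ... | x≡y , x∈X with EX.onto x x∈X
    ... | j , ej = j , ej , g_L.inj (trans (g_L.index-eq (χ j) (χ-L j)) (trans ej x≡y))
    from : (∃ λ j → χ j ≡ x × β₂ j ≡ y) → τ₁ x ≡ ι₂ y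
    from (j , refl , refl) = trans (τ-agree (χ j) (EX.into j)) (cong τ₂ (sym (g_L.index-eq (χ j) (χ-L j))))

  cover-V' : ∀ w → (∃ λ x → τ₁ x ≡ w) ⊎ (∃ λ y → ι₂ y ≡ w)
  cover-V' w with RV.cover w
  ... | inj₁ r = inj₁ r
  ... | inj₂ (y , hy , ey) = inj₂ (g_L.index y hy , trans (cong τ₂ (g_L.index-eq y hy)) ey)

  frame' : Graph v'
  frame' = glueGraph frame g_L.frame τ₁ ι₂ RV.inj₁ ι₂-inj

  coupled-frame : IsCoupledFrame frame g_L.frame χ β₂ frame' τ₁ ι₂
  coupled-frame = glueFrame RV.inj₁ ι₂-inj glue-X cover-V'

  -- f and g_L have the same marginal on X, since g_L is the marginal of f on L.
  f-g_L-compatible : restrict f χ ≈S restrict g_L.g β₂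
  f-g_L-compatible m G he ψ =
    trans (restrict-cong-β f (λ j → sym (g_L.index-eq (χ j) (χ-L j))) m G ψ) (sym (edge-marginal (edge L EL) β₂ m G he ψ))

  module CM = CoupledMarginals coupled-frame f g_L.g (𝔄-ext f-𝔄) (𝔄-ext g_L.g-𝔄)

  f' : Scheme v'
  f' = CM.f

  f'-𝔄 : InA frame' f'
  f'-𝔄 = couple f-𝔄 g_L.g-𝔄 χ β₂ EX.inj (g_L.index-inj χ χ-L EX.inj) f-g_L-compatible frame' τ₁ ι₂ coupled-frame

  frame'-adj : ∀ u w → (adj frame' u w ≡ true) ⇔ FrameAdj E' u w
  frame'-adj u w = mk⇔ to (λ fa → Equivalence.from (glueAdj-iff frame g_L.frame τ₁ ι₂ u w) (from (frame-edge⇒copy fa)))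
    where
    to : adj frame' u w ≡ true → FrameAdj E' u w
    to q with Equivalence.to (glueAdj-iff frame g_L.frame τ₁ ι₂ u w) q
    ... | inj₁ (x , y , a , ex , ey) = copy⇒frame-edge (inj₁ (x , y , Equivalence.to (frame-adj x y) a , ex , ey))
    ... | inj₂ (i , j , a , ei , ej) = copy⇒frame-edge
      (inj₂ (g_L.e i , g_L.e j , g_L.into i , g_L.into j , Equivalence.to (g_L.frame-adj i j) a , ei , ej))
    from : Copy₁ u w ⊎ Copy₂ u w → EdgeImage frame g_L.frame τ₁ ι₂ u w
    from (inj₁ (x , y , fa , ex , ey)) = inj₁ (x , y , Equivalence.from (frame-adj x y) fa , ex , ey)
    from (inj₂ (x , y , hx , hy , fa , ex , ey)) =
      inj₂ (g_L.index x hx , g_L.index y hy ,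
            Equivalence.from (g_L.frame-adj _ _) (subst₂ (FrameAdj E) (sym (g_L.index-eq x hx)) (sym (g_L.index-eq y hy)) fa) ,
            trans (cong τ₂ (g_L.index-eq x hx)) ex , trans (cong τ₂ (g_L.index-eq y hy)) ey)

  -- New edges τ₁ K: the edge scheme of K, seen through side 1 of f'.
  edge-τ₁ : ∀ K → E K → EdgeScheme E' f' (image τ₁ K)
  edge-τ₁ K EK = record
    { vertices  = record { size = P.size ; e = τ₁ ∘ P.e ; inj = λ q → P.inj (RV.inj₁ q)
                         ; into = λ i → ∈-image⁺ τ₁ K (P.e i) (P.into i) ; onto = onto }
    ; frame     = P.frame
    ; frame-adj = λ i j → ⇔-sym (frame-edge-τ₁ (P.e i) (P.e j)) ⇔-∘ P.frame-adj i j
    ; g         = P.g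
    ; g-𝔄       = P.g-𝔄
    ; marginal  = λ m G he ψ →
        trans (CM.coupled-marginal₁ f-g_L-compatible (𝔄-nonneg f-𝔄) P.e m G he ψ) (P.marginal m G he ψ) }
    where
    module P = EdgeScheme (edge K EK)
    onto : ∀ x → x ∈ image τ₁ K → ∃ λ i → τ₁ (P.e i) ≡ x
    onto x h with ∈-image⁻ τ₁ K x h
    ... | s , hs , refl = P.index s hs , cong τ₁ (P.index-eq s hs)

  -- New edges τ₂ K (K ⊆ L): the edge scheme of K, seen through side 2 of f'.
  edge-τ₂ : ∀ K → E K → K ⊆ L → EdgeScheme E' f' (image τ₂ K)
  edge-τ₂ K EK K⊆L = record
    { vertices  = record { size = P.size ; e = τ₂ ∘ P.e
                         ; inj = λ {a} {b} q → P.inj (RV.inj₂ _ _ (K⊆L (P.into a)) (K⊆L (P.into b)) q)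
                         ; into = λ i → ∈-image⁺ τ₂ K (P.e i) (P.into i) ; onto = onto }
    ; frame     = P.frame
    ; frame-adj = λ i j → ⇔-sym (frame-edge-τ₂ (P.e i) (P.e j) (K⊆L (P.into i)) (K⊆L (P.into j))) ⇔-∘ P.frame-adj i j
    ; g         = P.g
    ; g-𝔄       = P.g-𝔄
    ; marginal  = marginal }
    where
    module P = EdgeScheme (edge K EK)
    onto : ∀ x → x ∈ image τ₂ K → ∃ λ i → τ₂ (P.e i) ≡ x
    onto x h with ∈-image⁻ τ₂ K x h
    ... | s , hs , refl = P.index s hs , cong τ₂ (P.index-eq s hs)
    in-L : Fin P.size → Fin g_L.size
    in-L i = g_L.index (P.e i) (K⊆L (P.into i))
    in-L-eq : ∀ i → g_L.e (in-L i) ≡ P.e i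
    in-L-eq i = g_L.index-eq (P.e i) (K⊆L (P.into i))
    marginal : restrict f' (τ₂ ∘ P.e) ≈S P.g
    marginal m G he ψ = begin
      restrict f' (τ₂ ∘ P.e) m G ψ     ≡⟨ restrict-cong-β f' (λ i → cong τ₂ (sym (in-L-eq i))) m G ψ ⟩
      restrict f' (ι₂ ∘ in-L) m G ψ    ≡⟨ CM.coupled-marginal₂ f-g_L-compatible (𝔄-nonneg g_L.g-𝔄) in-L m G he ψ ⟩
      restrict g_L.g in-L m G ψ        ≡⟨ edge-marginal (edge L EL) in-L m G he ψ ⟩
      restrict f (g_L.e ∘ in-L) m G ψ  ≡⟨ restrict-cong-β f in-L-eq m G ψ ⟩
      restrict f P.e m G ψ             ≡⟨ P.marginal m G he ψ ⟩
      P.g m G ψ                        ∎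

  -- New edges τ₁ K₁ ∪ τ₂ K₂ (K₂ ⊆ L, X ⊆ K₁ ∩ K₂): the coupling of the edge
  -- schemes of K₁ and K₂ along X.
  module GluedEdge (K₁ K₂ : Subset v) (EK₁ : E K₁) (EK₂ : E K₂) (K₂⊆L : K₂ ⊆ L) (X⊆K : X ⊆ K₁ ∩ K₂) where
    module P₁ = EdgeScheme (edge K₁ EK₁)
    module P₂ = EdgeScheme (edge K₂ EK₂)

    K' : Subset v'
    K' = image τ₁ K₁ ∪ image τ₂ K₂

    module V' = Enumeration (enumerateSubset K')

    X⊆K₁ : X ⊆ K₁
    X⊆K₁ h = proj₁ (x∈p∩q⁻ K₁ K₂ (X⊆K h))

    X⊆K₂ : X ⊆ K₂
    X⊆K₂ h = proj₂ (x∈p∩q⁻ K₁ K₂ (X⊆K h))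

    P₂-L : ∀ y → P₂.e y ∈ L
    P₂-L y = K₂⊆L (P₂.into y)

    ι₁' : Fin P₁.size → Fin V'.size
    ι₁' x = V'.index (τ₁ (P₁.e x)) (x∈p∪q⁺ (inj₁ (∈-image⁺ τ₁ K₁ _ (P₁.into x))))

    ι₁'-eq : ∀ x → V'.e (ι₁' x) ≡ τ₁ (P₁.e x)
    ι₁'-eq x = V'.index-eq _ _

    ι₂' : Fin P₂.size → Fin V'.size
    ι₂' y = V'.index (τ₂ (P₂.e y)) (x∈p∪q⁺ (inj₂ (∈-image⁺ τ₂ K₂ _ (P₂.into y))))

    ι₂'-eq : ∀ y → V'.e (ι₂' y) ≡ τ₂ (P₂.e y)
    ι₂'-eq y = V'.index-eq _ _

    δ₁ : Fin EX.size → Fin P₁.size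
    δ₁ j = P₁.index (χ j) (X⊆K₁ (EX.into j))

    δ₁-eq : ∀ j → P₁.e (δ₁ j) ≡ χ j
    δ₁-eq j = P₁.index-eq (χ j) (X⊆K₁ (EX.into j))

    δ₂ : Fin EX.size → Fin P₂.size
    δ₂ j = P₂.index (χ j) (X⊆K₂ (EX.into j))

    δ₂-eq : ∀ j → P₂.e (δ₂ j) ≡ χ j
    δ₂-eq j = P₂.index-eq (χ j) (X⊆K₂ (EX.into j))

    ι₁'-inj : Injective ι₁'
    ι₁'-inj {a} {b} q = P₁.inj (RV.inj₁ (trans (sym (ι₁'-eq a)) (trans (cong V'.e q) (ι₁'-eq b))))

    ι₂'-inj : Injective ι₂'
    ι₂'-inj {a} {b} q = P₂.inj (RV.inj₂ _ _ (P₂-L a) (P₂-L b) (trans (sym (ι₂'-eq a)) (trans (cong V'.e q) (ι₂'-eq b))))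

    ι-δ : ∀ j → ι₁' (δ₁ j) ≡ ι₂' (δ₂ j)
    ι-δ j = V'.inj (begin
      V'.e (ι₁' (δ₁ j))  ≡⟨ ι₁'-eq (δ₁ j) ⟩
      τ₁ (P₁.e (δ₁ j))   ≡⟨ cong τ₁ (δ₁-eq j) ⟩
      τ₁ (χ j)           ≡⟨ τ-agree (χ j) (EX.into j) ⟩
      τ₂ (χ j)           ≡⟨ cong τ₂ (sym (δ₂-eq j)) ⟩
      τ₂ (P₂.e (δ₂ j))   ≡⟨ sym (ι₂'-eq (δ₂ j)) ⟩
      V'.e (ι₂' (δ₂ j))  ∎)

    glue-X' : ∀ x y → (ι₁' x ≡ ι₂' y) ⇔ (∃ λ j → δ₁ j ≡ x × δ₂ j ≡ y)
    glue-X' x y = mk⇔ to from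
      where
      to : ι₁' x ≡ ι₂' y → ∃ λ j → δ₁ j ≡ x × δ₂ j ≡ y
      to q with τ-meet (P₁.e x) (P₂.e y) (P₂-L y) (trans (sym (ι₁'-eq x)) (trans (cong V'.e q) (ι₂'-eq y)))
      ... | x≡y , x∈X with EX.onto (P₁.e x) x∈X
      ... | j , ej = j , P₁.inj (trans (δ₁-eq j) ej) , P₂.inj (trans (δ₂-eq j) (trans ej x≡y))
      from : (∃ λ j → δ₁ j ≡ x × δ₂ j ≡ y) → ι₁' x ≡ ι₂' y
      from (j , refl , refl) = ι-δ j

    cover-K' : ∀ i → (∃ λ x → ι₁' x ≡ i) ⊎ (∃ λ y → ι₂' y ≡ i)
    cover-K' i with x∈p∪q⁻ (image τ₁ K₁) (image τ₂ K₂) (V'.into i)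
    ... | inj₁ h with ∈-image⁻ τ₁ K₁ (V'.e i) h
    ...   | s , hs , es = inj₁ (P₁.index s hs , V'.inj (trans (ι₁'-eq _) (trans (cong τ₁ (P₁.index-eq s hs)) es)))
    cover-K' i | inj₂ h with ∈-image⁻ τ₂ K₂ (V'.e i) h
    ... | s , hs , es = inj₂ (P₂.index s hs , V'.inj (trans (ι₂'-eq _) (trans (cong τ₂ (P₂.index-eq s hs)) es)))

    frame'' : Graph V'.size
    frame'' = glueGraph P₁.frame P₂.frame ι₁' ι₂' ι₁'-inj ι₂'-inj

    coupled-frame'' : IsCoupledFrame P₁.frame P₂.frame δ₁ δ₂ frame'' ι₁' ι₂'
    coupled-frame'' = glueFrame ι₁'-inj ι₂'-inj glue-X' cover-K'

    τ₁-in-K' : ∀ x → τ₁ x ∈ K' → x ∈ K₁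
    τ₁-in-K' x h with x∈p∪q⁻ (image τ₁ K₁) (image τ₂ K₂) h
    ... | inj₁ h₁ with ∈-image⁻ τ₁ K₁ _ h₁
    ...   | s , hs , es = subst (_∈ K₁) (RV.inj₁ es) hs
    τ₁-in-K' x h | inj₂ h₂ with ∈-image⁻ τ₂ K₂ _ h₂
    ... | s , hs , es = X⊆K₁ (proj₂ (τ-meet x s (K₂⊆L hs) (sym es)))

    τ₂-in-K' : ∀ x → x ∈ L → τ₂ x ∈ K' → x ∈ K₂
    τ₂-in-K' x x∈L h with x∈p∪q⁻ (image τ₁ K₁) (image τ₂ K₂) h
    ... | inj₁ h₁ with ∈-image⁻ τ₁ K₁ _ h₁
    ...   | s , hs , es with τ-meet s x x∈L es
    ...     | s≡x , s∈X = subst (_∈ K₂) s≡x (X⊆K₂ s∈X)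
    τ₂-in-K' x x∈L h | inj₂ h₂ with ∈-image⁻ τ₂ K₂ _ h₂
    ... | s , hs , es = subst (_∈ K₂) (RV.inj₂ s x (K₂⊆L hs) x∈L es) hs

    copy⇒glued-edge : ∀ a b → Copy₁ (V'.e a) (V'.e b) ⊎ Copy₂ (V'.e a) (V'.e b) → EdgeImage P₁.frame P₂.frame ι₁' ι₂' a b
    copy⇒glued-edge a b (inj₁ (x , y , fa , ex , ey)) =
      inj₁ (P₁.index x hx , P₁.index y hy ,
            Equivalence.from (P₁.frame-adj _ _) (subst₂ (FrameAdj E) (sym (P₁.index-eq x hx)) (sym (P₁.index-eq y hy)) fa) ,
            V'.inj (trans (ι₁'-eq _) (trans (cong τ₁ (P₁.index-eq x hx)) ex)) ,
            V'.inj (trans (ι₁'-eq _) (trans (cong τ₁ (P₁.index-eq y hy)) ey)))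
      where
      hx : x ∈ K₁
      hx = τ₁-in-K' x (subst (_∈ K') (sym ex) (V'.into a))
      hy : y ∈ K₁
      hy = τ₁-in-K' y (subst (_∈ K') (sym ey) (V'.into b))
    copy⇒glued-edge a b (inj₂ (x , y , x∈L , y∈L , fa , ex , ey)) =
      inj₂ (P₂.index x hx , P₂.index y hy ,
            Equivalence.from (P₂.frame-adj _ _) (subst₂ (FrameAdj E) (sym (P₂.index-eq x hx)) (sym (P₂.index-eq y hy)) fa) ,
            V'.inj (trans (ι₂'-eq _) (trans (cong τ₂ (P₂.index-eq x hx)) ex)) ,
            V'.inj (trans (ι₂'-eq _) (trans (cong τ₂ (P₂.index-eq y hy)) ey)))
      where
      hx : x ∈ K₂
      hx = τ₂-in-K' x x∈L (subst (_∈ K') (sym ex) (V'.into a))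
      hy : y ∈ K₂
      hy = τ₂-in-K' y y∈L (subst (_∈ K') (sym ey) (V'.into b))

    frame''-adj : ∀ a b → (adj frame'' a b ≡ true) ⇔ FrameAdj E' (V'.e a) (V'.e b)
    frame''-adj a b = mk⇔ to (λ fa → Equivalence.from (glueAdj-iff P₁.frame P₂.frame ι₁' ι₂' a b)
                                                        (copy⇒glued-edge a b (frame-edge⇒copy fa)))
      where
      to : adj frame'' a b ≡ true → FrameAdj E' (V'.e a) (V'.e b)
      to q with Equivalence.to (glueAdj-iff P₁.frame P₂.frame ι₁' ι₂' a b) q
      ... | inj₁ (x , y , ad , refl , refl) = subst₂ (FrameAdj E') (sym (ι₁'-eq x)) (sym (ι₁'-eq y))
              (Equivalence.from (frame-edge-τ₁ _ _) (Equivalence.to (P₁.frame-adj x y) ad))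
      ... | inj₂ (x , y , ad , refl , refl) = subst₂ (FrameAdj E') (sym (ι₂'-eq x)) (sym (ι₂'-eq y))
              (Equivalence.from (frame-edge-τ₂ _ _ (P₂-L x) (P₂-L y)) (Equivalence.to (P₂.frame-adj x y) ad))

    g'' : Scheme V'.size
    g'' = coupled P₁.g P₂.g δ₁ ι₁' ι₂'

    -- The edge schemes of K₁ and K₂ have the same marginal on X, namely that of f.
    P₁-P₂-compatible : restrict P₁.g δ₁ ≈S restrict P₂.g δ₂
    P₁-P₂-compatible m G he ψ = begin
      restrict P₁.g δ₁ m G ψ        ≡⟨ edge-marginal (edge K₁ EK₁) δ₁ m G he ψ ⟩
      restrict f (P₁.e ∘ δ₁) m G ψ  ≡⟨ restrict-cong-β f (λ j → trans (δ₁-eq j) (sym (δ₂-eq j))) m G ψ ⟩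
      restrict f (P₂.e ∘ δ₂) m G ψ  ≡⟨ sym (edge-marginal (edge K₂ EK₂) δ₂ m G he ψ) ⟩
      restrict P₂.g δ₂ m G ψ        ∎

    g''-𝔄 : InA frame'' g''
    g''-𝔄 = couple P₁.g-𝔄 P₂.g-𝔄 δ₁ δ₂ (P₁.index-inj χ (X⊆K₁ ∘ EX.into) EX.inj) (P₂.index-inj χ (X⊆K₂ ∘ EX.into) EX.inj)
                   P₁-P₂-compatible frame'' ι₁' ι₂' coupled-frame''

    in-L : Fin P₂.size → Fin g_L.size
    in-L y = g_L.index (P₂.e y) (P₂-L y)

    in-L-eq : ∀ y → g_L.e (in-L y) ≡ P₂.e y
    in-L-eq y = g_L.index-eq (P₂.e y) (P₂-L y)

    glued-part : CM.GluedPart V'.size P₁.size P₂.size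
    glued-part = record
      { γ = V'.e ; γ₁ = P₁.e ; γ₂ = in-L ; δ₁ = δ₁ ; δ₂ = δ₂ ; ι₁' = ι₁' ; ι₂' = ι₂'
      ; γ-ι₁ = ι₁'-eq
      ; γ-ι₂ = λ y → trans (ι₂'-eq y) (cong τ₂ (sym (in-L-eq y)))
      ; γ₁-δ₁ = δ₁-eq
      ; γ₂-δ₂ = λ j → g_L.inj (trans (in-L-eq (δ₂ j)) (trans (δ₂-eq j) (sym (g_L.index-eq (χ j) (χ-L j)))))
      ; ι-δ = ι-δ
      ; ι-cover = cover-K' }

    marginal'' : restrict f' V'.e ≈S g''
    marginal'' m G he ψ = begin
      restrict f' V'.e m G ψ
        ≡⟨ CM.coupled-marginal-glued glued-part m G ψ ⟩
      coupled (restrict f P₁.e) (restrict g_L.g in-L) δ₁ ι₁' ι₂' m G ψ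
        ≡⟨ cong₂ divℚ (cong₂ _*_ (P₁.marginal m G he (ψ ∘ ι₁')) side₂) (restrict-≈ δ₁ P₁.marginal m G he (ψ ∘ ι₁' ∘ δ₁)) ⟩
      g'' m G ψ ∎
      where
      side₂ : restrict g_L.g in-L m G (ψ ∘ ι₂') ≡ P₂.g m G (ψ ∘ ι₂')
      side₂ = trans (edge-marginal (edge L EL) in-L m G he (ψ ∘ ι₂'))
                    (trans (restrict-cong-β f in-L-eq m G (ψ ∘ ι₂')) (P₂.marginal m G he (ψ ∘ ι₂')))

    edge-scheme : EdgeScheme E' f' K'
    edge-scheme = record { vertices = enumerateSubset K' ; frame = frame'' ; frame-adj = frame''-adj
                         ; g = g'' ; g-𝔄 = g''-𝔄 ; marginal = marginal'' }

  edge' : ∀ K' → E' K' → EdgeScheme E' f' K'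
  edge' _ (inj₁ (K , EK , refl))                                   = edge-τ₁ K EK
  edge' _ (inj₂ (inj₁ (K , EK , K⊆L , refl)))                      = edge-τ₂ K EK K⊆L
  edge' _ (inj₂ (inj₂ (K₁ , K₂ , (EK₁ , EK₂ , K₂⊆L , X⊆K) , refl))) = GluedEdge.edge-scheme K₁ K₂ EK₁ EK₂ K₂⊆L X⊆K

  two' : ∀ K' → E' K' → ∃₂ λ a b → a ≢ b × a ∈ K' × b ∈ K'
  two' _ (inj₁ (K , EK , refl)) with two K EK
  ... | a , b , a≢b , ha , hb = τ₁ a , τ₁ b , (λ q → a≢b (RV.inj₁ q)) , ∈-image⁺ τ₁ K a ha , ∈-image⁺ τ₁ K b hb
  two' _ (inj₂ (inj₁ (K , EK , K⊆L , refl))) with two K EK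
  ... | a , b , a≢b , ha , hb = τ₂ a , τ₂ b , (λ q → a≢b (RV.inj₂ a b (K⊆L ha) (K⊆L hb) q)) ,
                                ∈-image⁺ τ₂ K a ha , ∈-image⁺ τ₂ K b hb
  two' _ (inj₂ (inj₂ (K₁ , K₂ , (EK₁ , _) , refl))) with two K₁ EK₁
  ... | a , b , a≢b , ha , hb = τ₁ a , τ₁ b , (λ q → a≢b (RV.inj₁ q)) ,
                                x∈p∪q⁺ (inj₁ (∈-image⁺ τ₁ K₁ a ha)) , x∈p∪q⁺ (inj₁ (∈-image⁺ τ₁ K₁ b hb))

  invariant' : FrameInvariant v' E'
  invariant' = record { frame = frame' ; frame-adj = frame'-adj ; f = f' ; f-𝔄 = f'-𝔄 ; edge = edge' ; two = two' }

invariant : ∀ {v E B} → ReflectionComplex v E B → FrameInvariant v E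
invariant start                              = start-invariant
invariant (reflect N L X EL X⊆L τ₁ τ₂ RV) = Reflection.invariant' (invariant N) L X EL X⊆L τ₁ τ₂ RV

corollary8p3 : ∀ {v : ℕ} {E : Subset v → Set} {B : Subset v → Subset v → Set}
               → ReflectionComplex v E B → InS (FrameAdj E)
corollary8p3 {v} N = v , frame , f , f-𝔄 , ↔-id _ , frame-adj
  where open FrameInvariant (invariant N)
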